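{- Let $M$ be a regular matroid on $E$, $(\sigma,\sigma^*)$ a circuit-cocircuit signature of $M$, and $B\in\mathbf B(M)$. (1) For $e\in B$: $\vec F(B\setminus e,\sigma/e)=\vec F(B,\sigma)/e$ and $\vec F(B\setminus e,\sigma^*/e)=\vec F(B,\sigma^*)/e$. (2) For $e\in E\setminus B$: $\vec F(B,\sigma\setminus e)=\vec F(B,\sigma)\setminus e$ and $\vec F(B,\sigma^*\setminus e)=\vec F(B,\sigma^*)\setminus e$.
   Context: $M=M(A)$ is represented by a real totally unimodular matrix $A$ of full row rank with columns indexed by $E$; bases are index sets of nonsingular maximal square submatrices; circuits are minimal sets in no basis, cocircuits minimal sets meeting every basis; a loop lies in no basis and a coloop in every basis. A signed circuit (cocircuit) is an element of $\ker A$ (row space of $A$) with coefficients in $\{ -1,0,1\}$ whose support is a circuit (cocircuit); $\vec P\setminus e$ is the restriction of $\vec P\in\mathbb Z^E$ to $E\setminus\{e\}$. A circuit signature $\sigma$ picks for each circuit $C$ one of its two signed circuits $\sigma(C)$; a cocircuit signature $\sigma^*$ likewise. A fourientation is a map from the ground set to subsets of $\{+,-\}$; for a fourientation $\vec F$, $\vec F\setminus e$ and $\vec F/e$ both denote its restriction to $E\setminus\{e\}$. $\vec F(B,\sigma)$ is $\{+,-\}$ on $B$ and, at $x\notin B$, the sign of $\sigma(C_x)(x)$ where $C_x\subseteq B\cup\{x\}$ is the fundamental circuit; $\vec F(B,\sigma^*)$ is $\{+,-\}$ on $E\setminus B$ and, at $x\in B$, the sign of $\sigma^*(C^*_x)(x)$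 where $C^*_x\subseteq(E\setminus B)\cup\{x\}$ is the fundamental cocircuit. Minors: for $e$ not a coloop, $M\setminus e$ has bases $\{B:e\notin B\}$; for $e$ not a loop, $M/e$ has bases $\{B\setminus e:e\in B\}$. Signed circuits of $M\setminus e$: $\vec C\setminus e$ for signed circuits $\vec C$ of $M$ with $\vec C(e)=0$; of $M/e$: support-minimal nonzero elements of $\{\vec C\setminus e\}$; signed cocircuits of $M/e$: $\vec C^*\setminus e$ with $\vec C^*(e)=0$; of $M\setminus e$: support-minimal nonzero elements of $\{\vec C^*\setminus e\}$. $\sigma\setminus e=\{\vec C\setminus e:\vec C\in\sigma\}\cap\{\text{signed circuits of }M\setminus e\}$, $\sigma/e$ analogously for $M/e$, and similarly $\sigma^*\setminus e,\sigma^*/e$ with signed cocircuits. -}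

module Defs where

open import Data.Nat using (ℕ; zero; suc)
open import Data.Integer as ℤ using (ℤ; +_; -[1+_]; 0ℤ; 1ℤ; -1ℤ)
import Data.Integer.Properties as ℤP
open import Data.Rational as ℚ using (ℚ; 0ℚ)
open import Data.Fin using (Fin; zero; suc; punchIn)
open import Data.Fin.Subset using (Subset; _∈_; _∉_; _⊆_; _∪_; ⁅_⁆; ∁)
open import Data.Vec using (tabulate; lookup)
open import Data.Bool using (not)
open import Data.Product using (Σ; ∃; _×_; _,_)
open import Data.Sum using (_⊎_)
open import Relation.Nullary using (¬_)
open import Relation.Nullary.Decidable using (⌊_⌋)
open import Relation.Binary.PropositionalEquality using (_≡_; _≢_; _≗_)
open import Level using (0ℓ)

toℚ : ℤ → ℚ
toℚ z = z ℚ./ 1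

∑ℤ : ∀ {k} → (Fin k → ℤ) → ℤ
∑ℤ {zero}  f = 0ℤ
∑ℤ {suc k} f = f zero ℤ.+ ∑ℤ (λ i → f (suc i))

∑ℚ : ∀ {k} → (Fin k → ℚ) → ℚ
∑ℚ {zero}  f = 0ℚ
∑ℚ {suc k} f = f zero ℚ.+ ∑ℚ (λ i → f (suc i))

altSign : ∀ {k} → Fin k → ℤ
altSign zero    = 1ℤ
altSign (suc j) = ℤ.- altSign j

det : ∀ {k} → (Fin k → Fin k → ℤ) → ℤ
det {zero}  M = 1ℤ
det {suc k} M = ∑ℤ (λ j → altSign j ℤ.* (M zero j ℤ.* det (λ i l → M (suc i) (punchIn j l))))

Injective : ∀ {a b} → (Fin a → Fin b) → Set
Injective f = ∀ i j → f i ≡ f j → i ≡ j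

-- A real totally unimodular matrix has all entries in {-1,0,1} (1×1 minors),
-- so it is represented by an integer matrix.
Matrix : ℕ → ℕ → Set
Matrix m n = Fin m → Fin n → ℤ

TotallyUnimodular : ∀ {m n} → Matrix m n → Set
TotallyUnimodular {m} {n} A =
  ∀ k (r : Fin k → Fin m) (c : Fin k → Fin n) → Injective r → Injective c →
  (det (λ i j → A (r i) (c j)) ≡ 0ℤ ⊎ det (λ i j → A (r i) (c j)) ≡ 1ℤ
     ⊎ det (λ i j → A (r i) (c j)) ≡ -1ℤ)

FullRowRank : ∀ {m n} → Matrix m n → Set
FullRowRank {m} A =
  ∀ (y : Fin m → ℚ) → (∀ j → ∑ℚ (λ i → y i ℚ.* toℚ (A i j)) ≡ 0ℚ) → ∀ i → y i ≡ 0ℚ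

Vector : ℕ → Set
Vector n = Fin n → ℤ

Ternary : ∀ {n} → Vector n → Set
Ternary v = ∀ j → v j ≡ 0ℤ ⊎ v j ≡ 1ℤ ⊎ v j ≡ -1ℤ

supp : ∀ {n} → Vector n → Subset n
supp v = tabulate (λ j → not ⌊ v j ℤ.≟ 0ℤ ⌋)

Nonzero : ∀ {n} → Vector n → Set
Nonzero v = ∃ λ j → v j ≢ 0ℤ

InKernel : ∀ {m n} → Matrix m n → Vector n → Set
InKernel {m} {n} A v = ∀ i → ∑ℤ (λ j → A i j ℤ.* v j) ≡ 0ℤ

-- membership in the row space (over ℚ, equivalently over ℝ for rational data)
InRowSpace : ∀ {m n} → Matrix m n → Vector n → Set
InRowSpace {m} {n} A v =
  ∃ λ (y : Fin m → ℚ) → ∀ j → ∑ℚ (λ i → y i ℚ.* toℚ (A i j)) ≡ toℚ (v j)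

module _ {n : ℕ} (Basis : Subset n → Set) where
  Dependent : Subset n → Set
  Dependent C = ∀ B → Basis B → ¬ (C ⊆ B)

  IsCircuit : Subset n → Set
  IsCircuit C = Dependent C × (∀ X → X ⊆ C → Dependent X → X ≡ C)

  MeetsAll : Subset n → Set
  MeetsAll C = ∀ B → Basis B → ∃ λ x → x ∈ C × x ∈ B

  IsCocircuit : Subset n → Set
  IsCocircuit C = MeetsAll C × (∀ X → X ⊆ C → MeetsAll X → X ≡ C)

record MData (n : ℕ) : Set₁ where
  field
    Basis   : Subset n → Set
    SCirc   : Vector n → Set
    SCocirc : Vector n → Set
open MData public

Circuit : ∀ {n} → MData n → Subset n → Set
Circuit D = IsCircuit (Basis D)

Cocircuit : ∀ {n} → MData n → Subset n → Set
Cocircuit D = IsCocircuit (Basis D)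

-- bases: column index sets of nonsingular maximal (m × m, as A has full
-- row rank) square submatrices; c enumerates the columns of B
BasisA : ∀ {m n} → Matrix m n → Subset n → Set
BasisA {m} {n} A B =
  ∃ λ (c : Fin m → Fin n) → Injective c
    × (∀ i → c i ∈ B) × (∀ x → x ∈ B → ∃ λ i → c i ≡ x)
    × det (λ i j → A i (c j)) ≢ 0ℤ

MA : ∀ {m n} → Matrix m n → MData n
MA A = record
  { Basis   = BasisA A
  ; SCirc   = λ v → Ternary v × InKernel A v × IsCircuit (BasisA A) (supp v)
  ; SCocirc = λ v → Ternary v × InRowSpace A v × IsCocircuit (BasisA A) (supp v)
  }

-- Restriction to E ∖ {e}; E ∖ {e} is identified with Fin k via punchIn e

restrictS : ∀ {k} → Fin (suc k) → Subset (suc k) → Subset k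
restrictS e B = tabulate (λ i → lookup B (punchIn e i))

restrictV : ∀ {k} → Fin (suc k) → Vector (suc k) → Vector k
restrictV e v i = v (punchIn e i)

SupportMinimal : ∀ {n} → (Vector n → Set) → Vector n → Set
SupportMinimal P v = P v × Nonzero v ×
  (∀ w → P w → Nonzero w → supp w ⊆ supp v → supp w ≡ supp v)

ImageRestr : ∀ {k} → Fin (suc k) → (Vector (suc k) → Set) → Vector k → Set
ImageRestr e S w = ∃ λ v → S v × restrictV e v ≗ w

ImageRestr0 : ∀ {k} → Fin (suc k) → (Vector (suc k) → Set) → Vector k → Set
ImageRestr0 e S w = ∃ λ v → S v × v e ≡ 0ℤ × restrictV e v ≗ w

_∖_ : ∀ {k} → MData (suc k) → Fin (suc k) → MData k
D ∖ e = record
  { Basis   = λ B' → ∃ λ B → Basis D B × e ∉ B × restrictS e B ≡ B'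
  ; SCirc   = ImageRestr0 e (SCirc D)
  ; SCocirc = SupportMinimal (ImageRestr e (SCocirc D))
  }

_／_ : ∀ {k} → MData (suc k) → Fin (suc k) → MData k
D ／ e = record
  { Basis   = λ B' → ∃ λ B → Basis D B × e ∈ B × restrictS e B ≡ B'
  ; SCirc   = SupportMinimal (ImageRestr e (SCirc D))
  ; SCocirc = ImageRestr0 e (SCocirc D)
  }

Signature : ℕ → Set₁
Signature n = Vector n → Set

IsCircuitSignature : ∀ {n} → MData n → Signature n → Set
IsCircuitSignature D σ =
    (∀ v → σ v → SCirc D v)
  × (∀ C → Circuit D C → ∃ λ v → σ v × supp v ≡ C)
  × (∀ v w → σ v → σ w → supp v ≡ supp w → v ≗ w)

IsCocircuitSignature : ∀ {n} → MData n → Signature n → Set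
IsCocircuitSignature D σ* =
    (∀ v → σ* v → SCocirc D v)
  × (∀ C → Cocircuit D C → ∃ λ v → σ* v × supp v ≡ C)
  × (∀ v w → σ* v → σ* w → supp v ≡ supp w → v ≗ w)

sigDel : ∀ {k} → MData (suc k) → Signature (suc k) → Fin (suc k) → Signature k
sigDel D σ e w = ImageRestr e σ w × SCirc (D ∖ e) w

sigCon : ∀ {k} → MData (suc k) → Signature (suc k) → Fin (suc k) → Signature k
sigCon D σ e w = ImageRestr e σ w × SCirc (D ／ e) w

cosigDel : ∀ {k} → MData (suc k) → Signature (suc k) → Fin (suc k) → Signature k
cosigDel D σ* e w = ImageRestr e σ* w × SCocirc (D ∖ e) w

cosigCon : ∀ {k} → MData (suc k) → Signature (suc k) → Fin (suc k) → Signature k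
cosigCon D σ* e w = ImageRestr e σ* w × SCocirc (D ／ e) w

-- subsets of {+,-}
data Four : Set where
  ∅± plus minus both : Four

Fourientation : ℕ → Set
Fourientation n = Fin n → Four

signOf : ℤ → Four
signOf (+ zero)  = ∅±
signOf (+ suc _) = plus
signOf -[1+ _ ]  = minus

-- "F is F⃗(B,σ)": {+,-} on B; at x ∉ B, the sign of σ(C_x)(x), where C_x is
-- the (fundamental) circuit contained in B ∪ {x}; this requires that σ
-- contains a signed circuit supported on C_x and every such one gives F x.
IsFσ : ∀ {n} → MData n → Subset n → Signature n → Fourientation n → Set
IsFσ D B σ F = ∀ x →
    (x ∈ B → F x ≡ both)
  × (x ∉ B →
       (∃ λ c → σ c × Circuit D (supp c) × supp c ⊆ B ∪ ⁅ x ⁆)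
     × (∀ c → σ c → Circuit D (supp c) → supp c ⊆ B ∪ ⁅ x ⁆ → F x ≡ signOf (c x)))

-- "F is F⃗(B,σ*)": {+,-} on E ∖ B; at x ∈ B, the sign of σ*(C*_x)(x), where
-- C*_x is the (fundamental) cocircuit contained in (E ∖ B) ∪ {x}
IsFσ* : ∀ {n} → MData n → Subset n → Signature n → Fourientation n → Set
IsFσ* D B σ* F = ∀ x →
    (x ∉ B → F x ≡ both)
  × (x ∈ B →
       (∃ λ c → σ* c × Cocircuit D (supp c) × supp c ⊆ ∁ B ∪ ⁅ x ⁆)
     × (∀ c → σ* c → Cocircuit D (supp c) → supp c ⊆ ∁ B ∪ ⁅ x ⁆ → F x ≡ signOf (c x)))

-- F⃗ ∖ e = F⃗ / e : restriction to E ∖ {e}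
restrictF : ∀ {k} → Fin (suc k) → Fourientation (suc k) → Fourientation k
restrictF e F i = F (punchIn e i)

-- For x ≠ e write ι x for x viewed in E.  The fundamental circuit of ι x with respect to B lies in
-- B ∪ {ι x}; when e ∈ B restricting it contracts e away, and when e ∉ B it avoids e altogether.
-- Either way its restriction is the fundamental circuit of x with respect to B ∖ e in the minor,
-- so both fourientations take the same sign at x; cocircuits are dual.
--
-- Everything rests on a characterisation valid for any family of bases: a dependent W ⊆ Z is the
-- unique circuit inside Z as soon as every i ∈ W admits a basis between Z − i and Z (for
-- cocircuits, a basis whose complement lies between Z − i and Z).  This condition survives
-- contraction and deletion.  For M(A) the required bases are the exchanged bases (B − i) ∪ {y},
-- which exist by Cramer's rule together with the orthogonality of kernel and row space.

module Submission where

open import Defs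
open import Data.Nat using (ℕ; zero; suc)
import Data.Nat as ℕ
import Data.Nat.Properties as ℕₚ
open import Data.Integer as ℤ using (ℤ; 0ℤ; 1ℤ; -1ℤ; _+_; _*_; -_)
import Data.Integer.Properties as ℤₚ
open import Data.Integer.Tactic.RingSolver using (solve-∀)
open import Data.Rational as ℚ using (ℚ; 0ℚ)
import Data.Rational.Properties as ℚₚ
import Data.Rational.Unnormalised as ℚᵘ
import Data.Rational.Unnormalised.Properties as ℚᵘₚ
open import Data.Bool using (Bool; true; not)
open import Data.Fin using (Fin; zero; suc; punchIn; punchOut; inject₁; toℕ; _≟_)
open import Data.Fin.Properties using (punchInᵢ≢i; punchIn-injective; punchIn-punchOut; toℕ-injective; toℕ-inject₁; <-cmp; any?; all?; pigeonhole; <⇒≢)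
open import Data.Fin.Subset using (Subset; _∈_; _∉_; _⊆_; _⊂_; _∪_; ⁅_⁆; ∁; _-_)
open import Data.Fin.Subset.Properties using (_∈?_; _⊆?_; anySubset?; ⊆-antisym; p⊆p∪q; x∈p∪q⁺; x∈p∪q⁻; x∈⁅x⁆; x∈⁅y⁆⇒x≡y; x∈∁p⇒x∉p; x∉p⇒x∈∁p; x∉∁p⇒x∈p; x∈p∧x≢y⇒x∈p-y; x∈p⇒p-x⊂p; p─q⊆p)
open import Data.Fin.Subset.Induction using (Acc; acc; ⊂-wellFounded)
open import Data.Vec using (_∷_; tabulate; there)
open import Data.Vec.Properties using (lookup∘tabulate; []=⇒lookup; lookup⇒[]=; tabulate-cong)
open import Data.Vec.Functional using (updateAt)
open import Data.Vec.Functional.Properties using (updateAt-updates; updateAt-minimal; updateAt-id-local)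
open import Data.Product using (∃; _×_; _,_; proj₁; proj₂)
open import Data.Sum using (_⊎_; inj₁; inj₂)
open import Data.Empty using (⊥-elim)
open import Relation.Nullary using (¬_; Dec; yes; no)
open import Relation.Nullary.Decidable using (⌊_⌋; decidable-stable; _×-dec_; _→-dec_; ¬?; map′)
open import Relation.Binary using (tri<; tri≈; tri>)
open import Relation.Binary.PropositionalEquality
open import Function using (_∘_; const; id)
open import Algebra.Bundles using (Ring)
open import Algebra.Properties.Semiring.Sum ℤₚ.+-*-semiring using (sum; sum-cong-≗; sum-replicate-zero; sum-remove; ∑-comm; *-distribˡ-sum)
import Algebra.Properties.Semiring.Sum (Ring.semiring ℚₚ.+-*-ring) as ℚΣ

∑ℤ≡sum : ∀ {k} (f : Fin k → ℤ) → ∑ℤ f ≡ sum f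
∑ℤ≡sum {zero}  f = refl
∑ℤ≡sum {suc k} f = cong (f zero +_) (∑ℤ≡sum (λ i → f (suc i)))

sum-zero : ∀ {k} {f : Fin k → ℤ} → (∀ i → f i ≡ 0ℤ) → sum f ≡ 0ℤ
sum-zero {k} f≗0 = trans (sum-cong-≗ f≗0) (sum-replicate-zero k)

sum-neg : ∀ {k} (f : Fin k → ℤ) → sum (λ i → - f i) ≡ - sum f
sum-neg f = begin
  sum (λ i → - f i)      ≡⟨ sum-cong-≗ (λ i → sym (ℤₚ.-1*i≡-i (f i))) ⟩
  sum (λ i → -1ℤ * f i)  ≡⟨ *-distribˡ-sum -1ℤ f ⟨
  -1ℤ * sum f            ≡⟨ ℤₚ.-1*i≡-i (sum f) ⟩
  - sum f                ∎
  where open ≡-Reasoning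

sum-single : ∀ {k} (f : Fin k → ℤ) a → (∀ t → t ≢ a → f t ≡ 0ℤ) → sum f ≡ f a
sum-single {suc k} f a f≗0 = begin
  sum f                              ≡⟨ sum-remove {i = a} f ⟩
  f a + sum (λ i → f (punchIn a i))  ≡⟨ cong (f a +_) (sum-zero (λ i → f≗0 _ (punchInᵢ≢i a i))) ⟩
  f a + 0ℤ                           ≡⟨ ℤₚ.+-identityʳ (f a) ⟩
  f a                                ∎
  where open ≡-Reasoning

sum-pair : ∀ {k} (f : Fin k → ℤ) a b → a ≢ b →
  (∀ t → t ≢ a → t ≢ b → f t ≡ 0ℤ) → sum f ≡ f a + f b
sum-pair {suc k} f a b a≢b f≗0 = begin
  sum f                               ≡⟨ sum-remove {i = a} f ⟩
  f a + sum (λ i → f (punchIn a i))   ≡⟨ cong (f a +_) (sum-single _ b′ f′≗0) ⟩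
  f a + f (punchIn a b′)              ≡⟨ cong (λ t → f a + f t) (punchIn-punchOut a≢b) ⟩
  f a + f b                           ∎
  where
  open ≡-Reasoning
  b′ = punchOut a≢b
  f′≗0 : ∀ t → t ≢ b′ → f (punchIn a t) ≡ 0ℤ
  f′≗0 t t≢b′ = f≗0 _ (punchInᵢ≢i a t) λ eq →
    t≢b′ (punchIn-injective a t b′ (trans eq (sym (punchIn-punchOut a≢b))))

Square : ℕ → Set
Square k = Fin k → Fin k → ℤ

minor : ∀ {k} → Fin (suc k) → Square (suc k) → Square k
minor j M i l = M (suc i) (punchIn j l)

laplaceTerm : ∀ {k} → Square (suc k) → Fin (suc k) → ℤ
laplaceTerm M l = altSign l * (M zero l * det (minor l M))

det-expand : ∀ {k} (M : Square (suc k)) → det M ≡ sum (laplaceTerm M)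
det-expand M = ∑ℤ≡sum (laplaceTerm M)

det-cong : ∀ {k} {M N : Square k} → (∀ i j → M i j ≡ N i j) → det M ≡ det N
det-cong {zero}  M≗N = refl
det-cong {suc k} {M} {N} M≗N = trans (det-expand M) (trans (sum-cong-≗ same-terms) (sym (det-expand N)))
  where
  same-terms : ∀ j → laplaceTerm M j ≡ laplaceTerm N j
  same-terms j = cong₂ (λ a d → altSign j * (a * d)) (M≗N zero j)
                       (det-cong (λ i l → M≗N (suc i) (punchIn j l)))

swapAdjacent : ∀ {k} → Fin (suc k) → Fin (suc (suc k)) → Fin (suc (suc k))
swapAdjacent zero          zero          = suc zero
swapAdjacent zero          (suc zero)    = zero
swapAdjacent zero          (suc (suc i)) = suc (suc i)
swapAdjacent {suc k} (suc p) zero    = zero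
swapAdjacent {suc k} (suc p) (suc i) = suc (swapAdjacent p i)

swapAdjacent-inject₁ : ∀ {k} (p : Fin (suc k)) → swapAdjacent p (inject₁ p) ≡ suc p
swapAdjacent-inject₁ zero = refl
swapAdjacent-inject₁ {suc k} (suc p) = cong suc (swapAdjacent-inject₁ p)

swapAdjacent-suc : ∀ {k} (p : Fin (suc k)) → swapAdjacent p (suc p) ≡ inject₁ p
swapAdjacent-suc zero = refl
swapAdjacent-suc {suc k} (suc p) = cong suc (swapAdjacent-suc p)

swapAdjacent-fixes : ∀ {k} (p : Fin (suc k)) l → l ≢ inject₁ p → l ≢ suc p → swapAdjacent p l ≡ l
swapAdjacent-fixes zero zero                l≢p l≢p+1 = ⊥-elim (l≢p refl)
swapAdjacent-fixes zero (suc zero)          l≢p l≢p+1 = ⊥-elim (l≢p+1 refl)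
swapAdjacent-fixes zero (suc (suc l))       l≢p l≢p+1 = refl
swapAdjacent-fixes {suc k} (suc p) zero     l≢p l≢p+1 = refl
swapAdjacent-fixes {suc k} (suc p) (suc l)  l≢p l≢p+1 =
  cong suc (swapAdjacent-fixes p l (l≢p ∘ cong suc) (l≢p+1 ∘ cong suc))

swapAdjacent-punchIn-inject₁ : ∀ {k} (p t : Fin (suc k)) →
  swapAdjacent p (punchIn (inject₁ p) t) ≡ punchIn (suc p) t
swapAdjacent-punchIn-inject₁ zero zero = refl
swapAdjacent-punchIn-inject₁ zero (suc t) = refl
swapAdjacent-punchIn-inject₁ {suc k} (suc p) zero = refl
swapAdjacent-punchIn-inject₁ {suc k} (suc p) (suc t) = cong suc (swapAdjacent-punchIn-inject₁ p t)

swapAdjacent-punchIn-suc : ∀ {k} (p t : Fin (suc k)) →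
  swapAdjacent p (punchIn (suc p) t) ≡ punchIn (inject₁ p) t
swapAdjacent-punchIn-suc zero zero = refl
swapAdjacent-punchIn-suc zero (suc t) = refl
swapAdjacent-punchIn-suc {suc k} (suc p) zero = refl
swapAdjacent-punchIn-suc {suc k} (suc p) (suc t) = cong suc (swapAdjacent-punchIn-suc p t)

swapAdjacent-punchIn : ∀ {k} (p : Fin (suc (suc k))) l → l ≢ inject₁ p → l ≢ suc p →
  ∃ λ p′ → ∀ t → swapAdjacent p (punchIn l t) ≡ punchIn l (swapAdjacent p′ t)
swapAdjacent-punchIn zero zero                l≢p l≢p+1 = ⊥-elim (l≢p refl)
swapAdjacent-punchIn zero (suc zero)          l≢p l≢p+1 = ⊥-elim (l≢p+1 refl)
swapAdjacent-punchIn zero (suc (suc l))       l≢p l≢p+1 = zero , λ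
  { zero → refl ; (suc zero) → refl ; (suc (suc t)) → refl }
swapAdjacent-punchIn (suc p) zero             l≢p l≢p+1 = p , λ t → refl
swapAdjacent-punchIn {zero} (suc zero) (suc zero)       l≢p l≢p+1 = ⊥-elim (l≢p refl)
swapAdjacent-punchIn {zero} (suc zero) (suc (suc zero)) l≢p l≢p+1 = ⊥-elim (l≢p+1 refl)
swapAdjacent-punchIn {suc k} (suc p) (suc l)  l≢p l≢p+1
  with p′ , commutes ← swapAdjacent-punchIn p l (l≢p ∘ cong suc) (l≢p+1 ∘ cong suc) =
  suc p′ , λ { zero → refl ; (suc t) → cong suc (commutes t) }

sum-swapAdjacent : ∀ {k} (f : Fin (suc (suc k)) → ℤ) p → sum (f ∘ swapAdjacent p) ≡ sum f
sum-swapAdjacent f zero = exchange (f zero) (f (suc zero)) (sum (λ i → f (suc (suc i))))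
  where
  exchange : ∀ a b c → b + (a + c) ≡ a + (b + c)
  exchange = solve-∀
sum-swapAdjacent {suc k} f (suc p) = cong (f zero +_) (sum-swapAdjacent (λ i → f (suc i)) p)

altSign-inject₁ : ∀ {k} (p : Fin k) → altSign (inject₁ p) ≡ altSign p
altSign-inject₁ zero = refl
altSign-inject₁ (suc p) = cong -_ (altSign-inject₁ p)

det-swapAdjacent : ∀ {k} (M : Square (suc (suc k))) p →
  det (λ r i → M r (swapAdjacent p i)) ≡ - det M
det-swapAdjacent {k} M p = begin
  det M′                                           ≡⟨ det-expand M′ ⟩
  sum (laplaceTerm M′)                            ≡⟨ sum-cong-≗ swapped ⟩
  sum (λ l → - laplaceTerm M (swapAdjacent p l))  ≡⟨ sum-neg (laplaceTerm M ∘ swapAdjacent p) ⟩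
  - sum (laplaceTerm M ∘ swapAdjacent p)          ≡⟨ cong -_ (sum-swapAdjacent (laplaceTerm M) p) ⟩
  - sum (laplaceTerm M)                           ≡⟨ cong -_ (det-expand M) ⟨
  - det M                                          ∎
  where
  open ≡-Reasoning
  M′ : Square (suc (suc k))
  M′ r i = M r (swapAdjacent p i)

  minor-swapped : ∀ {k} (M : Square (suc (suc k))) p l → l ≢ inject₁ p → l ≢ suc p →
    det (minor l (λ r i → M r (swapAdjacent p i))) ≡ - det (minor l M)
  minor-swapped {zero} M zero zero l≢p _ = ⊥-elim (l≢p refl)
  minor-swapped {zero} M zero (suc zero) _ l≢p+1 = ⊥-elim (l≢p+1 refl)
  minor-swapped {suc k} M p l l≢p l≢p+1
    with p′ , commutes ← swapAdjacent-punchIn p l l≢p l≢p+1 =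
    trans (det-cong (λ r t → cong (M (suc r)) (commutes t))) (det-swapAdjacent (minor l M) p′)

  swapped : ∀ l → laplaceTerm M′ l ≡ - laplaceTerm M (swapAdjacent p l)
  swapped l with l ≟ inject₁ p | l ≟ suc p
  ... | yes refl | _ rewrite swapAdjacent-inject₁ p | altSign-inject₁ p =
    trans (cong (λ d → altSign p * (M zero (suc p) * d))
                (det-cong (λ r t → cong (M (suc r)) (swapAdjacent-punchIn-inject₁ p t))))
          (negate-twice (altSign p) (M zero (suc p)) (det (minor (suc p) M)))
    where
    negate-twice : ∀ s a d → s * (a * d) ≡ - (- s * (a * d))
    negate-twice = solve-∀
  ... | no _ | yes refl rewrite swapAdjacent-suc p | altSign-inject₁ p =
    trans (cong (λ d → - altSign p * (M zero (inject₁ p) * d))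
                (det-cong (λ r t → cong (M (suc r)) (swapAdjacent-punchIn-suc p t))))
          (negate-outside (altSign p) (M zero (inject₁ p)) (det (minor (inject₁ p) M)))
    where
    negate-outside : ∀ s a d → - s * (a * d) ≡ - (s * (a * d))
    negate-outside = solve-∀
  ... | no l≢p | no l≢p+1 rewrite swapAdjacent-fixes p l l≢p l≢p+1 =
    trans (cong (λ d → altSign l * (M zero l * d)) (minor-swapped M p l l≢p l≢p+1))
          (negate-inside (altSign l) (M zero l) (det (minor l M)))
    where
    negate-inside : ∀ s a d → s * (a * - d) ≡ - (s * (a * d))
    negate-inside = solve-∀

det-equal-adjacent : ∀ {k} (M : Square (suc (suc k))) p →
  (∀ r → M r (inject₁ p) ≡ M r (suc p)) → det M ≡ 0ℤ
det-equal-adjacent M p same = x≡-x⇒x≡0 (det M) (trans (det-cong unchanged) (det-swapAdjacent M p))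
  where
  unchanged : ∀ r i → M r i ≡ M r (swapAdjacent p i)
  unchanged r i with i ≟ inject₁ p | i ≟ suc p
  ... | yes refl | _ rewrite swapAdjacent-inject₁ p = same r
  ... | no _ | yes refl rewrite swapAdjacent-suc p = sym (same r)
  ... | no i≢p | no i≢p+1 rewrite swapAdjacent-fixes p i i≢p i≢p+1 = refl
  x≡-x⇒x≡0 : ∀ x → x ≡ - x → x ≡ 0ℤ
  x≡-x⇒x≡0 (ℤ.+ zero)  _ = refl
  x≡-x⇒x≡0 (ℤ.+ suc n) ()
  x≡-x⇒x≡0 ℤ.-[1+ n ]  ()

-- Column b is moved left by adjacent swaps until it is next to column a; d counts the swaps.
det-equal-columns-at-distance : ∀ d {k} (M : Square k) a b → suc (toℕ a) ℕ.+ d ≡ toℕ b →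
  (∀ r → M r a ≡ M r b) → det M ≡ 0ℤ
det-equal-columns-at-distance d {suc zero} M zero zero () _
det-equal-columns-at-distance zero {suc (suc k)} M a (suc p) a+1≡p+1 same
  with refl ← toℕ-injective (trans (sym (ℕₚ.+-identityʳ (toℕ a)))
                (trans (ℕₚ.suc-injective a+1≡p+1) (sym (toℕ-inject₁ p)))) =
  det-equal-adjacent M p same
det-equal-columns-at-distance (suc d) {suc (suc k)} M a (suc p) a+d+2≡p+1 same =
  trans (sym (ℤₚ.neg-involutive (det M)))
        (cong -_ (trans (sym (det-swapAdjacent M p))
                        (det-equal-columns-at-distance d M′ a (inject₁ p) a+d+1≡p same′)))
  where
  M′ : Square (suc (suc k))
  M′ r i = M r (swapAdjacent p i)
  a+d+1≡p : suc (toℕ a) ℕ.+ d ≡ toℕ (inject₁ p)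
  a+d+1≡p = trans (sym (ℕₚ.+-suc (toℕ a) d)) (trans (ℕₚ.suc-injective a+d+2≡p+1) (sym (toℕ-inject₁ p)))
  a≢p : a ≢ inject₁ p
  a≢p refl = ℕₚ.m+1+n≢m (toℕ a) (trans (ℕₚ.+-suc (toℕ a) d) a+d+1≡p)
  a≢p+1 : a ≢ suc p
  a≢p+1 refl = ℕₚ.m+1+n≢m (toℕ a) (trans (ℕₚ.+-suc (toℕ a) (suc d)) a+d+2≡p+1)
  same′ : ∀ r → M′ r a ≡ M′ r (inject₁ p)
  same′ r rewrite swapAdjacent-fixes p a a≢p a≢p+1 | swapAdjacent-inject₁ p = same r

det-equal-columns : ∀ {k} (M : Square k) a b → a ≢ b → (∀ r → M r a ≡ M r b) → det M ≡ 0ℤ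
det-equal-columns M a b a≢b same with <-cmp a b
... | tri< a<b _ _ = let d , eq = ℕₚ.m≤n⇒∃[o]m+o≡n a<b in det-equal-columns-at-distance d M a b eq same
... | tri≈ _ a≡b _ = ⊥-elim (a≢b a≡b)
... | tri> _ _ b<a = let d , eq = ℕₚ.m≤n⇒∃[o]m+o≡n b<a in
  det-equal-columns-at-distance d M b a eq (λ r → sym (same r))

AgreeOffColumn : ∀ {k} → Fin k → Square k → Square k → Set
AgreeOffColumn j M N = ∀ r i → i ≢ j → M r i ≡ N r i

LinearInColumn : ∀ {k} → (Square k → ℤ) → Fin k → Square k → Set
LinearInColumn {k} f j N = ∃ λ (γ : Fin k → ℤ) →
  ∀ M → AgreeOffColumn j M N → f M ≡ sum (λ r → M r j * γ r)

sum-linearInColumn : ∀ {k} {f : Square k → ℤ} {g : Square k → Fin k → ℤ} {j N} →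
  (∀ l → LinearInColumn (λ M → g M l) j N) → (∀ M → sum (g M) ≡ f M) → LinearInColumn f j N
sum-linearInColumn {k} {f} {g} {j} {N} linear sum≡f = γ , expand
  where
  δ : Fin k → Fin k → ℤ
  δ l = proj₁ (linear l)
  γ : Fin k → ℤ
  γ r = sum (λ l → δ l r)
  expand : ∀ M → AgreeOffColumn j M N → f M ≡ sum (λ r → M r j * γ r)
  expand M agree = begin
    f M                                    ≡⟨ sum≡f M ⟨
    sum (g M)                              ≡⟨ sum-cong-≗ (λ l → proj₂ (linear l) M agree) ⟩
    sum (λ l → sum (λ r → M r j * δ l r)) ≡⟨ ∑-comm (λ l r → M r j * δ l r) ⟩
    sum (λ r → sum (λ l → M r j * δ l r)) ≡⟨ sum-cong-≗ (λ r → *-distribˡ-sum (M r j) (λ l → δ l r)) ⟨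
    sum (λ r → M r j * γ r)                ∎
    where open ≡-Reasoning

laplaceTerm-linearInColumn-at : ∀ {k} (N : Square (suc k)) l →
  LinearInColumn (λ M → laplaceTerm M l) l N
laplaceTerm-linearInColumn-at {k} N l = δ , expand
  where
  δ : Fin (suc k) → ℤ
  δ zero    = altSign l * det (minor l N)
  δ (suc r) = 0ℤ
  expand : ∀ M → AgreeOffColumn l M N → laplaceTerm M l ≡ sum (λ r → M r l * δ r)
  expand M agree = begin
    altSign l * (M zero l * det (minor l M))
      ≡⟨ cong (λ d → altSign l * (M zero l * d))
              (det-cong (λ r t → agree (suc r) (punchIn l t) (punchInᵢ≢i l t))) ⟩
    altSign l * (M zero l * det (minor l N))
      ≡⟨ regroup (altSign l) (M zero l) (det (minor l N)) ⟩
    M zero l * δ zero + 0ℤ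
      ≡⟨ cong (M zero l * δ zero +_) (sum-zero (λ r → ℤₚ.*-zeroʳ (M (suc r) l))) ⟨
    M zero l * δ zero + sum (λ r → M (suc r) l * 0ℤ)
      ∎
    where
    open ≡-Reasoning
    regroup : ∀ s a d → s * (a * d) ≡ a * (s * d) + 0ℤ
    regroup = solve-∀

linearInColumn-away : ∀ {k} (N : Square (suc (suc k))) j l (l≢j : l ≢ j) →
  LinearInColumn det (punchOut l≢j) (minor l N) →
  LinearInColumn (λ M → laplaceTerm M l) j N
linearInColumn-away {k} N j l l≢j (γ′ , minor-linear) = δ , expand
  where
  j′ = punchOut l≢j
  δ : Fin (suc (suc k)) → ℤ
  δ zero    = 0ℤ
  δ (suc r) = altSign l * (N zero l * γ′ r)
  expand : ∀ M → AgreeOffColumn j M N → laplaceTerm M l ≡ sum (λ r → M r j * δ r)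
  expand M agree = begin
    altSign l * (M zero l * det (minor l M))
      ≡⟨ cong₂ (λ a d → altSign l * (a * d)) (agree zero l l≢j) (minor-linear (minor l M) minor-agree) ⟩
    altSign l * (N zero l * sum (λ r → M (suc r) (punchIn l j′) * γ′ r))
      ≡⟨ cong (λ c → altSign l * (N zero l * sum (λ r → M (suc r) c * γ′ r))) (punchIn-punchOut l≢j) ⟩
    altSign l * (N zero l * sum (λ r → M (suc r) j * γ′ r))
      ≡⟨ cong (altSign l *_) (*-distribˡ-sum (N zero l) (λ r → M (suc r) j * γ′ r)) ⟩
    altSign l * sum (λ r → N zero l * (M (suc r) j * γ′ r))
      ≡⟨ *-distribˡ-sum (altSign l) (λ r → N zero l * (M (suc r) j * γ′ r)) ⟩
    sum (λ r → altSign l * (N zero l * (M (suc r) j * γ′ r)))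
      ≡⟨ sum-cong-≗ (λ r → regroup (altSign l) (N zero l) (M (suc r) j) (γ′ r)) ⟩
    sum (λ r → M (suc r) j * δ (suc r))
      ≡⟨ ℤₚ.+-identityˡ _ ⟨
    0ℤ + sum (λ r → M (suc r) j * δ (suc r))
      ≡⟨ cong (_+ sum (λ r → M (suc r) j * δ (suc r))) (ℤₚ.*-zeroʳ (M zero j)) ⟨
    M zero j * δ zero + sum (λ r → M (suc r) j * δ (suc r))
      ∎
    where
    open ≡-Reasoning
    regroup : ∀ s a m g → s * (a * (m * g)) ≡ m * (s * (a * g))
    regroup = solve-∀
    minor-agree : AgreeOffColumn j′ (minor l M) (minor l N)
    minor-agree r t t≢j′ = agree (suc r) (punchIn l t) λ eq →
      t≢j′ (punchIn-injective l t j′ (trans eq (sym (punchIn-punchOut l≢j))))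

mutual
  det-linearInColumn : ∀ {k} (N : Square k) j → LinearInColumn det j N
  det-linearInColumn {suc k} N j =
    sum-linearInColumn (laplaceTerm-linearInColumn N j) (λ M → sym (det-expand M))

  laplaceTerm-linearInColumn : ∀ {k} (N : Square (suc k)) j l →
    LinearInColumn (λ M → laplaceTerm M l) j N
  laplaceTerm-linearInColumn N j l with l ≟ j
  ... | yes refl = laplaceTerm-linearInColumn-at N l
  ... | no l≢j = laplaceTerm-linearInColumn-away N j l l≢j

  laplaceTerm-linearInColumn-away : ∀ {k} (N : Square (suc k)) j l → l ≢ j →
    LinearInColumn (λ M → laplaceTerm M l) j N
  laplaceTerm-linearInColumn-away {zero} N zero zero l≢j = ⊥-elim (l≢j refl)
  laplaceTerm-linearInColumn-away {suc k} N j l l≢j =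
    linearInColumn-away N j l l≢j (det-linearInColumn (minor l N) (punchOut l≢j))

toℚᵘ-toℚ : ∀ a → ℚ.toℚᵘ (toℚ a) ℚᵘ.≃ ℚᵘ.mkℚᵘ a 0
toℚᵘ-toℚ a = ℚₚ.toℚᵘ-fromℚᵘ (ℚᵘ.mkℚᵘ a 0)

toℚ-+ : ∀ a b → toℚ (a + b) ≡ toℚ a ℚ.+ toℚ b
toℚ-+ a b = ℚₚ.toℚᵘ-injective (ℚᵘₚ.≃-trans (toℚᵘ-toℚ (a + b)) (ℚᵘₚ.≃-trans
  (ℚᵘ.*≡* (unit-denominators a b))
  (ℚᵘₚ.≃-sym (ℚᵘₚ.≃-trans (ℚₚ.toℚᵘ-homo-+ (toℚ a) (toℚ b)) (ℚᵘₚ.+-cong (toℚᵘ-toℚ a) (toℚᵘ-toℚ b))))))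
  where
  unit-denominators : ∀ a b → (a + b) * 1ℤ ≡ (a * 1ℤ + b * 1ℤ) * 1ℤ
  unit-denominators = solve-∀

toℚ-* : ∀ a b → toℚ (a * b) ≡ toℚ a ℚ.* toℚ b
toℚ-* a b = ℚₚ.toℚᵘ-injective (ℚᵘₚ.≃-trans (toℚᵘ-toℚ (a * b)) (ℚᵘₚ.≃-trans
  (ℚᵘ.*≡* refl)
  (ℚᵘₚ.≃-sym (ℚᵘₚ.≃-trans (ℚₚ.toℚᵘ-homo-* (toℚ a) (toℚ b)) (ℚᵘₚ.*-cong (toℚᵘ-toℚ a) (toℚᵘ-toℚ b))))))

toℚ-injective₀ : ∀ a → toℚ a ≡ 0ℚ → a ≡ 0ℤ
toℚ-injective₀ a eq
  with ℚᵘ.*≡* a*1≡0 ← ℚᵘₚ.≃-trans (ℚᵘₚ.≃-sym (toℚᵘ-toℚ a)) (ℚᵘₚ.≃-trans (ℚₚ.toℚᵘ-cong eq) (toℚᵘ-toℚ 0ℤ)) =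
  trans (sym (ℤₚ.*-identityʳ a)) a*1≡0

toℚ-sum : ∀ {k} (f : Fin k → ℤ) → toℚ (sum f) ≡ ℚΣ.sum (toℚ ∘ f)
toℚ-sum {zero}  f = refl
toℚ-sum {suc k} f = trans (toℚ-+ (f zero) (sum (λ i → f (suc i))))
                          (cong (toℚ (f zero) ℚ.+_) (toℚ-sum (λ i → f (suc i))))

∑ℚ≡sum : ∀ {k} (f : Fin k → ℚ) → ∑ℚ f ≡ ℚΣ.sum f
∑ℚ≡sum {zero}  f = refl
∑ℚ≡sum {suc k} f = cong (f zero ℚ.+_) (∑ℚ≡sum (λ i → f (suc i)))

module _ {m n} (A : Matrix m n) where

  rowSpace⊥kernel : ∀ {w v} → InRowSpace A w → InKernel A v → sum (λ t → w t * v t) ≡ 0ℤ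
  rowSpace⊥kernel {w} {v} (y , yA≡w) Av≡0 = toℚ-injective₀ (sum (λ t → w t * v t)) (begin
    toℚ (sum (λ t → w t * v t))
      ≡⟨ toℚ-sum (λ t → w t * v t) ⟩
    ℚΣ.sum (λ t → toℚ (w t * v t))
      ≡⟨ ℚΣ.sum-cong-≗ (λ t → trans (toℚ-* (w t) (v t)) (cong (ℚ._* toℚ (v t)) (yA≡w′ t))) ⟩
    ℚΣ.sum (λ t → ℚΣ.sum (λ r → y r ℚ.* toℚ (A r t)) ℚ.* toℚ (v t))
      ≡⟨ ℚΣ.sum-cong-≗ (λ t → ℚΣ.*-distribʳ-sum (toℚ (v t)) (λ r → y r ℚ.* toℚ (A r t))) ⟩
    ℚΣ.sum (λ t → ℚΣ.sum (λ r → y r ℚ.* toℚ (A r t) ℚ.* toℚ (v t)))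
      ≡⟨ ℚΣ.∑-comm (λ t r → y r ℚ.* toℚ (A r t) ℚ.* toℚ (v t)) ⟩
    ℚΣ.sum (λ r → ℚΣ.sum (λ t → y r ℚ.* toℚ (A r t) ℚ.* toℚ (v t)))
      ≡⟨ ℚΣ.sum-cong-≗ (λ r → trans (ℚΣ.sum-cong-≗ (λ t → ℚₚ.*-assoc (y r) (toℚ (A r t)) (toℚ (v t))))
                                     (sym (ℚΣ.*-distribˡ-sum (y r) (λ t → toℚ (A r t) ℚ.* toℚ (v t))))) ⟩
    ℚΣ.sum (λ r → y r ℚ.* ℚΣ.sum (λ t → toℚ (A r t) ℚ.* toℚ (v t)))
      ≡⟨ ℚΣ.sum-cong-≗ (λ r → cong (y r ℚ.*_) (row-vanishes r)) ⟩
    ℚΣ.sum (λ r → y r ℚ.* 0ℚ)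
      ≡⟨ trans (ℚΣ.sum-cong-≗ (λ r → ℚₚ.*-zeroʳ (y r))) (ℚΣ.sum-replicate-zero m) ⟩
    0ℚ ∎)
    where
    open ≡-Reasoning
    yA≡w′ : ∀ t → toℚ (w t) ≡ ℚΣ.sum (λ r → y r ℚ.* toℚ (A r t))
    yA≡w′ t = trans (sym (yA≡w t)) (∑ℚ≡sum (λ r → y r ℚ.* toℚ (A r t)))
    row-vanishes : ∀ r → ℚΣ.sum (λ t → toℚ (A r t) ℚ.* toℚ (v t)) ≡ 0ℚ
    row-vanishes r = begin
      ℚΣ.sum (λ t → toℚ (A r t) ℚ.* toℚ (v t)) ≡⟨ ℚΣ.sum-cong-≗ (λ t → toℚ-* (A r t) (v t)) ⟨
      ℚΣ.sum (λ t → toℚ (A r t * v t))         ≡⟨ toℚ-sum (λ t → A r t * v t) ⟨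
      toℚ (sum (λ t → A r t * v t))            ≡⟨ cong toℚ (trans (sym (∑ℤ≡sum (λ t → A r t * v t))) (Av≡0 r)) ⟩
      0ℚ                                        ∎

  rowCombination-inRowSpace : (γ : Fin m → ℤ) → InRowSpace A (λ t → sum (λ r → A r t * γ r))
  rowCombination-inRowSpace γ = toℚ ∘ γ , λ t → begin
    ∑ℚ (λ r → toℚ (γ r) ℚ.* toℚ (A r t))     ≡⟨ ∑ℚ≡sum (λ r → toℚ (γ r) ℚ.* toℚ (A r t)) ⟩
    ℚΣ.sum (λ r → toℚ (γ r) ℚ.* toℚ (A r t)) ≡⟨ ℚΣ.sum-cong-≗ (λ r → trans (ℚₚ.*-comm (toℚ (γ r)) (toℚ (A r t)))
                                                                      (sym (toℚ-* (A r t) (γ r)))) ⟩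
    ℚΣ.sum (λ r → toℚ (A r t * γ r))         ≡⟨ toℚ-sum (λ r → A r t * γ r) ⟨
    toℚ (sum (λ r → A r t * γ r))            ∎
    where open ≡-Reasoning

  rowSpace⊥kernel-pair : ∀ {w v} a b → InRowSpace A w → InKernel A v → a ≢ b →
    (∀ t → t ≢ a → t ≢ b → w t ≡ 0ℤ ⊎ v t ≡ 0ℤ) → w a ≢ 0ℤ → v a ≢ 0ℤ → w b ≢ 0ℤ × v b ≢ 0ℤ
  rowSpace⊥kernel-pair {w} {v} a b w∈A v∈ker a≢b disjoint wa≢0 va≢0 =
    (λ wb≡0 → wbvb≢0 (cong (_* v b) wb≡0)) , (λ vb≡0 → wbvb≢0 (trans (cong (w b *_) vb≡0) (ℤₚ.*-zeroʳ (w b))))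
    where
    product≡0 : ∀ t → t ≢ a → t ≢ b → w t * v t ≡ 0ℤ
    product≡0 t t≢a t≢b with disjoint t t≢a t≢b
    ... | inj₁ wt≡0 = cong (_* v t) wt≡0
    ... | inj₂ vt≡0 = trans (cong (w t *_) vt≡0) (ℤₚ.*-zeroʳ (w t))
    pair≡0 : w a * v a + w b * v b ≡ 0ℤ
    pair≡0 = trans (sym (sum-pair (λ t → w t * v t) a b a≢b product≡0)) (rowSpace⊥kernel {w} {v} w∈A v∈ker)
    wbvb≢0 : w b * v b ≢ 0ℤ
    wbvb≢0 eq with ℤₚ.i*j≡0⇒i≡0∨j≡0 (w a) (trans (sym (ℤₚ.+-identityʳ (w a * v a))) (trans (cong (w a * v a +_) (sym eq)) pair≡0))
    ... | inj₁ wa≡0 = wa≢0 wa≡0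
    ... | inj₂ va≡0 = va≢0 va≡0

  inRowSpace-≗ : ∀ {v w} → v ≗ w → InRowSpace A v → InRowSpace A w
  inRowSpace-≗ v≗w (y , yA≡v) = y , λ t → trans (yA≡v t) (cong toℚ (v≗w t))

∈-tabulate⁺ : ∀ {n} {f : Fin n → Bool} {x} → f x ≡ true → x ∈ tabulate f
∈-tabulate⁺ {f = f} {x} fx≡true = lookup⇒[]= x (tabulate f) (trans (lookup∘tabulate f x) fx≡true)

∈-tabulate⁻ : ∀ {n} {f : Fin n → Bool} {x} → x ∈ tabulate f → f x ≡ true
∈-tabulate⁻ {f = f} {x} x∈ = trans (sym (lookup∘tabulate f x)) ([]=⇒lookup x∈)

module _ {n} {v : Vector n} {x : Fin n} where

  ∈-supp⁺ : v x ≢ 0ℤ → x ∈ supp v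
  ∈-supp⁺ vx≢0 = ∈-tabulate⁺ (nonzero (v x ℤ.≟ 0ℤ))
    where
    nonzero : (d : Dec (v x ≡ 0ℤ)) → not ⌊ d ⌋ ≡ true
    nonzero (yes vx≡0) = ⊥-elim (vx≢0 vx≡0)
    nonzero (no _)     = refl

  ∈-supp⁻ : x ∈ supp v → v x ≢ 0ℤ
  ∈-supp⁻ x∈ = nonzero (v x ℤ.≟ 0ℤ) (∈-tabulate⁻ x∈)
    where
    nonzero : (d : Dec (v x ≡ 0ℤ)) → not ⌊ d ⌋ ≡ true → v x ≢ 0ℤ
    nonzero (no vx≢0) _ = vx≢0

  ∉-supp : x ∉ supp v → v x ≡ 0ℤ
  ∉-supp x∉ = decidable-stable (v x ℤ.≟ 0ℤ) (x∉ ∘ ∈-supp⁺)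

supp-cong : ∀ {n} {v w : Vector n} → v ≗ w → supp v ≡ supp w
supp-cong v≗w = tabulate-cong (λ j → cong (λ a → not ⌊ a ℤ.≟ 0ℤ ⌋) (v≗w j))

x∉p-x : ∀ {n} (p : Subset n) x → x ∉ p - x
x∉p-x (_ ∷ p) zero    ()
x∉p-x (_ ∷ p) (suc x) (there x∈) = x∉p-x p x x∈

x∈p-y⁻ : ∀ {n} {p : Subset n} {x y} → x ∈ p - y → x ∈ p × x ≢ y
x∈p-y⁻ {p = p} {x} {y} x∈ = p─q⊆p p ⁅ y ⁆ x∈ , λ { refl → x∉p-x p x x∈ }

x∈p∪⁅y⁆⁻ : ∀ {n} {p : Subset n} {x y} → x ∈ p ∪ ⁅ y ⁆ → x ∈ p ⊎ x ≡ y
x∈p∪⁅y⁆⁻ {p = p} {y = y} x∈ with x∈p∪q⁻ p ⁅ y ⁆ x∈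
... | inj₁ x∈p = inj₁ x∈p
... | inj₂ x∈y = inj₂ (x∈⁅y⁆⇒x≡y y x∈y)

x∈p∪⁅y⁆⁺ : ∀ {n} {p : Subset n} {x y} → x ∈ p ⊎ x ≡ y → x ∈ p ∪ ⁅ y ⁆
x∈p∪⁅y⁆⁺ (inj₁ x∈p) = x∈p∪q⁺ (inj₁ x∈p)
x∈p∪⁅y⁆⁺ {y = y} (inj₂ refl) = x∈p∪q⁺ (inj₂ (x∈⁅x⁆ y))

module _ {k} (e : Fin (suc k)) where

  e-or-punchIn : ∀ t → t ≡ e ⊎ ∃ λ i → punchIn e i ≡ t
  e-or-punchIn t with t ≟ e
  ... | yes t≡e = inj₁ t≡e
  ... | no t≢e  = inj₂ (punchOut (t≢e ∘ sym) , punchIn-punchOut (t≢e ∘ sym))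

  ∈-restrictS⁺ : ∀ {Y i} → punchIn e i ∈ Y → i ∈ restrictS e Y
  ∈-restrictS⁺ ιi∈Y = ∈-tabulate⁺ ([]=⇒lookup ιi∈Y)

  ∈-restrictS⁻ : ∀ {Y i} → i ∈ restrictS e Y → punchIn e i ∈ Y
  ∈-restrictS⁻ {Y} i∈ = lookup⇒[]= _ Y (∈-tabulate⁻ i∈)

  restrictS-mono : ∀ {X Y} → X ⊆ Y → restrictS e X ⊆ restrictS e Y
  restrictS-mono X⊆Y = ∈-restrictS⁺ ∘ X⊆Y ∘ ∈-restrictS⁻

  ⊆-unrestrictS : ∀ {X Y} → restrictS e X ⊆ restrictS e Y → e ∉ X ⊎ e ∈ Y → X ⊆ Y
  ⊆-unrestrictS {X} {Y} X′⊆Y′ at-e {t} t∈X with e-or-punchIn t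
  ... | inj₂ (i , refl) = ∈-restrictS⁻ (X′⊆Y′ (∈-restrictS⁺ t∈X))
  ... | inj₁ refl with at-e
  ...   | inj₁ e∉X = ⊥-elim (e∉X t∈X)
  ...   | inj₂ e∈Y = e∈Y

  restrictS-≡ : ∀ {Y X} → (∀ {i} → punchIn e i ∈ Y → i ∈ X) → (∀ {i} → i ∈ X → punchIn e i ∈ Y) →
    restrictS e Y ≡ X
  restrictS-≡ into onto = ⊆-antisym (into ∘ ∈-restrictS⁻) (∈-restrictS⁺ ∘ onto)

  restrictS-∪⁅⁆ : ∀ Y x → restrictS e (Y ∪ ⁅ punchIn e x ⁆) ≡ restrictS e Y ∪ ⁅ x ⁆
  restrictS-∪⁅⁆ Y x = restrictS-≡ into onto
    where
    into : ∀ {i} → punchIn e i ∈ Y ∪ ⁅ punchIn e x ⁆ → i ∈ restrictS e Y ∪ ⁅ x ⁆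
    into ιi∈ with x∈p∪⁅y⁆⁻ ιi∈
    ... | inj₁ ιi∈Y = x∈p∪⁅y⁆⁺ (inj₁ (∈-restrictS⁺ ιi∈Y))
    ... | inj₂ ιi≡ιx = x∈p∪⁅y⁆⁺ (inj₂ (punchIn-injective e _ _ ιi≡ιx))
    onto : ∀ {i} → i ∈ restrictS e Y ∪ ⁅ x ⁆ → punchIn e i ∈ Y ∪ ⁅ punchIn e x ⁆
    onto i∈ with x∈p∪⁅y⁆⁻ i∈
    ... | inj₁ i∈Y′ = x∈p∪⁅y⁆⁺ (inj₁ (∈-restrictS⁻ i∈Y′))
    ... | inj₂ refl = x∈p∪⁅y⁆⁺ (inj₂ refl)

  restrictS-∁ : ∀ Y → restrictS e (∁ Y) ≡ ∁ (restrictS e Y)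
  restrictS-∁ Y = restrictS-≡ (λ ιi∈∁Y → x∉p⇒x∈∁p (x∈∁p⇒x∉p ιi∈∁Y ∘ ∈-restrictS⁻ {Y}))
                              (λ i∈∁Y′ → x∉p⇒x∈∁p (x∈∁p⇒x∉p i∈∁Y′ ∘ ∈-restrictS⁺ {Y}))

  restrictS-- : ∀ Y i → restrictS e (Y - punchIn e i) ≡ restrictS e Y - i
  restrictS-- Y i = restrictS-≡ into onto
    where
    into : ∀ {j} → punchIn e j ∈ Y - punchIn e i → j ∈ restrictS e Y - i
    into ιj∈ with ιj∈Y , ιj≢ιi ← x∈p-y⁻ ιj∈ =
      x∈p∧x≢y⇒x∈p-y (∈-restrictS⁺ ιj∈Y) (ιj≢ιi ∘ cong (punchIn e))
    onto : ∀ {j} → j ∈ restrictS e Y - i → punchIn e j ∈ Y - punchIn e i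
    onto j∈ with j∈Y′ , j≢i ← x∈p-y⁻ j∈ =
      x∈p∧x≢y⇒x∈p-y (∈-restrictS⁻ j∈Y′) (j≢i ∘ punchIn-injective e _ _)

  supp-restrictV : ∀ v → supp (restrictV e v) ≡ restrictS e (supp v)
  supp-restrictV v = tabulate-cong (λ i → sym (lookup∘tabulate (λ j → not ⌊ v j ℤ.≟ 0ℤ ⌋) (punchIn e i)))

module _ {n} {p : Subset n} where

  p∪⁅y⁆-y⊆p : ∀ {y} → (p ∪ ⁅ y ⁆) - y ⊆ p
  p∪⁅y⁆-y⊆p x∈ with x∈p+y , x≢y ← x∈p-y⁻ x∈ with x∈p∪⁅y⁆⁻ x∈p+y
  ... | inj₁ x∈p = x∈p
  ... | inj₂ x≡y = ⊥-elim (x≢y x≡y)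

  p∪⁅y⁆-i⊆p-i∪⁅y⁆ : ∀ {y i} → (p ∪ ⁅ y ⁆) - i ⊆ (p - i) ∪ ⁅ y ⁆
  p∪⁅y⁆-i⊆p-i∪⁅y⁆ x∈ with x∈p+y , x≢i ← x∈p-y⁻ x∈ with x∈p∪⁅y⁆⁻ x∈p+y
  ... | inj₁ x∈p = x∈p∪⁅y⁆⁺ (inj₁ (x∈p∧x≢y⇒x∈p-y x∈p x≢i))
  ... | inj₂ x≡y = x∈p∪⁅y⁆⁺ (inj₂ x≡y)

  p-i∪⁅y⁆⊆p∪⁅y⁆ : ∀ {y i} → (p - i) ∪ ⁅ y ⁆ ⊆ p ∪ ⁅ y ⁆
  p-i∪⁅y⁆⊆p∪⁅y⁆ x∈ with x∈p∪⁅y⁆⁻ x∈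
  ... | inj₁ x∈p-i = x∈p∪⁅y⁆⁺ (inj₁ (proj₁ (x∈p-y⁻ x∈p-i)))
  ... | inj₂ x≡y = x∈p∪⁅y⁆⁺ (inj₂ x≡y)

  ∁p∪⁅x⁆-i⊆∁[p-x∪⁅i⁆] : ∀ {x i} → (∁ p ∪ ⁅ x ⁆) - i ⊆ ∁ ((p - x) ∪ ⁅ i ⁆)
  ∁p∪⁅x⁆-i⊆∁[p-x∪⁅i⁆] {x} {i} {t} t∈ = x∉p⇒x∈∁p t∉
    where
    t∉ : t ∉ (p - x) ∪ ⁅ i ⁆
    t∉ t∈p-x+i with t∈∁p+x , t≢i ← x∈p-y⁻ t∈ with x∈p∪⁅y⁆⁻ t∈p-x+i
    ... | inj₂ t≡i = t≢i t≡i
    ... | inj₁ t∈p-x with t∈p , t≢x ← x∈p-y⁻ t∈p-x with x∈p∪⁅y⁆⁻ t∈∁p+x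
    ...   | inj₁ t∈∁p = x∈∁p⇒x∉p t∈∁p t∈p
    ...   | inj₂ t≡x = t≢x t≡x

  ∁[p-x∪⁅i⁆]⊆∁p∪⁅x⁆ : ∀ {x i} → ∁ ((p - x) ∪ ⁅ i ⁆) ⊆ ∁ p ∪ ⁅ x ⁆
  ∁[p-x∪⁅i⁆]⊆∁p∪⁅x⁆ {x} {i} {t} t∈ with t ∈? p | t ≟ x
  ... | no t∉p | _        = x∈p∪⁅y⁆⁺ (inj₁ (x∉p⇒x∈∁p t∉p))
  ... | yes _  | yes t≡x  = x∈p∪⁅y⁆⁺ (inj₂ t≡x)
  ... | yes t∈p | no t≢x  = ⊥-elim (x∈∁p⇒x∉p t∈ (x∈p∪⁅y⁆⁺ (inj₁ (x∈p∧x≢y⇒x∈p-y t∈p t≢x))))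

module _ {k} (e : Fin (suc k)) where

  ∈-supp-restrictV⁺ : ∀ c {i} → punchIn e i ∈ supp c → i ∈ supp (restrictV e c)
  ∈-supp-restrictV⁺ c = subst (_ ∈_) (sym (supp-restrictV e c)) ∘ ∈-restrictS⁺ e

  ∈-supp-restrictV⁻ : ∀ c {i} → i ∈ supp (restrictV e c) → punchIn e i ∈ supp c
  ∈-supp-restrictV⁻ c = ∈-restrictS⁻ e ∘ subst (_ ∈_) (supp-restrictV e c)

  module Restriction {Z : Subset (suc k)} {Z′ : Subset k} (Z′≡ : restrictS e Z ≡ Z′) where

    supp-restrictV-⊆ : ∀ c → supp c ⊆ Z → supp (restrictV e c) ⊆ Z′
    supp-restrictV-⊆ c c⊆Z rewrite supp-restrictV e c | sym Z′≡ = restrictS-mono e c⊆Z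

    supp-unrestrict-⊆ : ∀ v {w} → restrictV e v ≗ w → supp w ⊆ Z′ → e ∉ supp v ⊎ e ∈ Z → supp v ⊆ Z
    supp-unrestrict-⊆ v v≗w w⊆Z′ at-e rewrite sym Z′≡ =
      ⊆-unrestrictS e (subst (_⊆ _) (trans (supp-cong (sym ∘ v≗w)) (supp-restrictV e v)) w⊆Z′) at-e

    between-restrict : ∀ (R : Subset k → Subset k → Set) {i} →
      R (restrictS e (Z - punchIn e i)) (restrictS e Z) → R (Z′ - i) Z′
    between-restrict R {i} rewrite restrictS-- e Z i | Z′≡ = λ between → between

  minimal-vanishes-at-e : ∀ {P : Subset (suc k) → Set} v v′ {w} → P (supp v′) →
    (∀ X → X ⊆ supp v → P X → X ≡ supp v) → v′ e ≡ 0ℤ →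
    restrictV e v ≗ w → restrictV e v′ ≗ w → v e ≡ 0ℤ
  minimal-vanishes-at-e v v′ P-v′ v-minimal v′e≡0 v≗w v′≗w =
    ∉-supp {v = v} (λ e∈v → ∈-supp⁻ {v = v′} (subst (e ∈_) (sym (v-minimal (supp v′) v′⊆v P-v′)) e∈v) v′e≡0)
    where
    v′⊆v : supp v′ ⊆ supp v
    v′⊆v {t} t∈v′ with e-or-punchIn e t
    ... | inj₁ refl = ⊥-elim (∈-supp⁻ {v = v′} t∈v′ v′e≡0)
    ... | inj₂ (i , refl) = ∈-supp⁺ {v = v} (∈-supp⁻ {v = v′} t∈v′ ∘ trans (trans (v′≗w i) (sym (v≗w i))))

module _ {n} (Basis : Subset n → Set) where

  BasisBetween : Subset n → Subset n → Set
  BasisBetween L U = ∃ λ B → Basis B × L ⊆ B × B ⊆ U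

  CobasisBetween : Subset n → Subset n → Set
  CobasisBetween L U = ∃ λ B → Basis B × L ⊆ ∁ B × ∁ B ⊆ U

  dependent-⊇ : ∀ {W X Z} → X ⊆ Z → Dependent Basis X →
    (∀ {i} → i ∈ W → BasisBetween (Z - i) Z) → W ⊆ X
  dependent-⊇ {X = X} X⊆Z X-dep between {i} i∈W with i ∈? X
  ... | yes i∈X = i∈X
  ... | no i∉X with B , B-basis , Z-i⊆B , _ ← between i∈W =
    ⊥-elim (X-dep B B-basis (λ t∈X → Z-i⊆B (x∈p∧x≢y⇒x∈p-y (X⊆Z t∈X) λ { refl → i∉X t∈X })))

  meetsAll-⊇ : ∀ {W X Z} → X ⊆ Z → MeetsAll Basis X →
    (∀ {i} → i ∈ W → CobasisBetween (Z - i) Z) → W ⊆ X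
  meetsAll-⊇ {X = X} X⊆Z X-meets between {i} i∈W with i ∈? X
  ... | yes i∈X = i∈X
  ... | no i∉X with B , B-basis , Z-i⊆∁B , _ ← between i∈W
    with t , t∈X , t∈B ← X-meets B B-basis =
    ⊥-elim (x∈∁p⇒x∉p (Z-i⊆∁B (x∈p∧x≢y⇒x∈p-y (X⊆Z t∈X) λ { refl → i∉X t∈X })) t∈B)

  isCircuit-fundamental : ∀ {W Z} → W ⊆ Z → Dependent Basis W →
    (∀ {i} → i ∈ W → BasisBetween (Z - i) Z) → IsCircuit Basis W
  isCircuit-fundamental W⊆Z W-dep between =
    W-dep , λ X X⊆W X-dep → ⊆-antisym X⊆W (dependent-⊇ (W⊆Z ∘ X⊆W) X-dep between)

  isCocircuit-fundamental : ∀ {W Z} → W ⊆ Z → MeetsAll Basis W →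
    (∀ {i} → i ∈ W → CobasisBetween (Z - i) Z) → IsCocircuit Basis W
  isCocircuit-fundamental W⊆Z W-meets between =
    W-meets , λ X X⊆W X-meets → ⊆-antisym X⊆W (meetsAll-⊇ (W⊆Z ∘ X⊆W) X-meets between)

  circuit-unique : ∀ {W X Z} → Dependent Basis W → (∀ {i} → i ∈ W → BasisBetween (Z - i) Z) →
    X ⊆ Z → IsCircuit Basis X → W ≡ X
  circuit-unique W-dep between X⊆Z (X-dep , X-minimal) =
    X-minimal _ (dependent-⊇ X⊆Z X-dep between) W-dep

  cocircuit-unique : ∀ {W X Z} → MeetsAll Basis W → (∀ {i} → i ∈ W → CobasisBetween (Z - i) Z) →
    X ⊆ Z → IsCocircuit Basis X → W ≡ X
  cocircuit-unique W-meets between X⊆Z (X-meets , X-minimal) =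
    X-minimal _ (meetsAll-⊇ X⊆Z X-meets between) W-meets

  dependent-∋ : ∀ {B X y} → Basis B → X ⊆ B ∪ ⁅ y ⁆ → Dependent Basis X → y ∈ X
  dependent-∋ {B} {X} {y} B-basis X⊆B+y X-dep with y ∈? X
  ... | yes y∈X = y∈X
  ... | no y∉X = ⊥-elim (X-dep B B-basis λ {t} t∈X → in-B t∈X (x∈p∪⁅y⁆⁻ (X⊆B+y t∈X)))
    where
    in-B : ∀ {t} → t ∈ X → t ∈ B ⊎ t ≡ y → t ∈ B
    in-B _   (inj₁ t∈B)  = t∈B
    in-B t∈X (inj₂ refl) = ⊥-elim (y∉X t∈X)

  meetsAll-∋ : ∀ {B X x} → Basis B → X ⊆ ∁ B ∪ ⁅ x ⁆ → MeetsAll Basis X → x ∈ X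
  meetsAll-∋ B-basis X⊆∁B+x X-meets with t , t∈X , t∈B ← X-meets _ B-basis
    with x∈p∪⁅y⁆⁻ (X⊆∁B+x t∈X)
  ... | inj₁ t∈∁B = ⊥-elim (x∈∁p⇒x∉p t∈∁B t∈B)
  ... | inj₂ refl = t∈X

module _ {n} (Basis : Subset n → Set) (dependent? : ∀ X → Dec (Dependent Basis X)) where

  circuit-⊆ : ∀ {D} → Dependent Basis D → ∃ λ C → C ⊆ D × IsCircuit Basis C
  circuit-⊆ {D} = shrink D (⊂-wellFounded D)
    where
    shrink : ∀ D → Acc _⊂_ D → Dependent Basis D → ∃ λ C → C ⊆ D × IsCircuit Basis C
    shrink D (acc smaller) D-dep with any? (λ x → x ∈? D ×-dec dependent? (D - x))
    ... | yes (x , x∈D , D-x-dep) with C , C⊆D-x , C-circuit ← shrink (D - x) (smaller (x∈p⇒p-x⊂p x∈D)) D-x-dep =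
      C , p─q⊆p D ⁅ x ⁆ ∘ C⊆D-x , C-circuit
    ... | no no-removable = D , id , D-dep , minimal
      where
      minimal : ∀ X → X ⊆ D → Dependent Basis X → X ≡ D
      minimal X X⊆D X-dep = ⊆-antisym X⊆D D⊆X
        where
        D⊆X : D ⊆ X
        D⊆X {t} t∈D with t ∈? X
        ... | yes t∈X = t∈X
        ... | no t∉X = ⊥-elim (no-removable (t , t∈D , λ B B-basis D-t⊆B →
          X-dep B B-basis (λ s∈X → D-t⊆B (x∈p∧x≢y⇒x∈p-y (X⊆D s∈X) λ { refl → t∉X s∈X }))))

module _ {k} (D : MData (suc k)) (e : Fin (suc k)) where

  basisBetween-／ : ∀ {L U} → e ∈ L → BasisBetween (Basis D) L U →
    BasisBetween (Basis (D ／ e)) (restrictS e L) (restrictS e U)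
  basisBetween-／ e∈L (B , B-basis , L⊆B , B⊆U) =
    restrictS e B , (B , B-basis , L⊆B e∈L , refl) , restrictS-mono e L⊆B , restrictS-mono e B⊆U

  basisBetween-∖ : ∀ {L U} → e ∉ U → BasisBetween (Basis D) L U →
    BasisBetween (Basis (D ∖ e)) (restrictS e L) (restrictS e U)
  basisBetween-∖ e∉U (B , B-basis , L⊆B , B⊆U) =
    restrictS e B , (B , B-basis , e∉U ∘ B⊆U , refl) , restrictS-mono e L⊆B , restrictS-mono e B⊆U

  restrictS-∁-mono : ∀ {X Y} → X ⊆ ∁ Y → restrictS e X ⊆ ∁ (restrictS e Y)
  restrictS-∁-mono {Y = Y} X⊆∁Y = subst (_ ⊆_) (restrictS-∁ e Y) (restrictS-mono e X⊆∁Y)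

  ∁-restrictS-mono : ∀ {X Y} → ∁ Y ⊆ X → ∁ (restrictS e Y) ⊆ restrictS e X
  ∁-restrictS-mono {Y = Y} ∁Y⊆X = subst (_⊆ _) (restrictS-∁ e Y) (restrictS-mono e ∁Y⊆X)

  cobasisBetween-／ : ∀ {L U} → e ∉ U → CobasisBetween (Basis D) L U →
    CobasisBetween (Basis (D ／ e)) (restrictS e L) (restrictS e U)
  cobasisBetween-／ e∉U (B , B-basis , L⊆∁B , ∁B⊆U) =
    restrictS e B , (B , B-basis , x∉∁p⇒x∈p (e∉U ∘ ∁B⊆U) , refl) ,
    restrictS-∁-mono L⊆∁B , ∁-restrictS-mono ∁B⊆U

  cobasisBetween-∖ : ∀ {L U} → e ∈ L → CobasisBetween (Basis D) L U →
    CobasisBetween (Basis (D ∖ e)) (restrictS e L) (restrictS e U)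
  cobasisBetween-∖ e∈L (B , B-basis , L⊆∁B , ∁B⊆U) =
    restrictS e B , (B , B-basis , x∈∁p⇒x∉p (L⊆∁B e∈L) , refl) ,
    restrictS-∁-mono L⊆∁B , ∁-restrictS-mono ∁B⊆U

  dependent-／ : ∀ {S} → Dependent (Basis D) S → Dependent (Basis (D ／ e)) (restrictS e S)
  dependent-／ S-dep _ (B , B-basis , e∈B , refl) S′⊆B′ = S-dep B B-basis (⊆-unrestrictS e S′⊆B′ (inj₂ e∈B))

  dependent-∖ : ∀ {S} → e ∉ S → Dependent (Basis D) S → Dependent (Basis (D ∖ e)) (restrictS e S)
  dependent-∖ e∉S S-dep _ (B , B-basis , _ , refl) S′⊆B′ = S-dep B B-basis (⊆-unrestrictS e S′⊆B′ (inj₁ e∉S))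

  meetsAll-／ : ∀ {S} → e ∉ S → MeetsAll (Basis D) S → MeetsAll (Basis (D ／ e)) (restrictS e S)
  meetsAll-／ e∉S S-meets _ (B , B-basis , _ , refl)
    with t , t∈S , t∈B ← S-meets B B-basis | e-or-punchIn e t
  ... | inj₁ refl = ⊥-elim (e∉S t∈S)
  ... | inj₂ (i , refl) = i , ∈-restrictS⁺ e t∈S , ∈-restrictS⁺ e t∈B

  meetsAll-∖ : ∀ {S} → MeetsAll (Basis D) S → MeetsAll (Basis (D ∖ e)) (restrictS e S)
  meetsAll-∖ S-meets _ (B , B-basis , e∉B , refl)
    with t , t∈S , t∈B ← S-meets B B-basis | e-or-punchIn e t
  ... | inj₁ refl = ⊥-elim (e∉B t∈B)
  ... | inj₂ (i , refl) = i , ∈-restrictS⁺ e t∈S , ∈-restrictS⁺ e t∈B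

module _ {k} (e : Fin (suc k)) where

  restrictV-supportMinimal : ∀ {S : Vector (suc k) → Set} {c} → S c → Nonzero (restrictV e c) →
    (∀ v → S v → supp (restrictV e v) ⊆ supp (restrictV e c) → supp c ≡ supp v) →
    SupportMinimal (ImageRestr e S) (restrictV e c)
  restrictV-supportMinimal {S} {c} S-c nonzero c-minimal = (c , S-c , λ _ → refl) , nonzero , minimal
    where
    minimal : ∀ u → ImageRestr e S u → Nonzero u → supp u ⊆ supp (restrictV e c) → supp u ≡ supp (restrictV e c)
    minimal u (v , S-v , v≗u) _ u⊆w = begin
      supp u                  ≡⟨ supp-cong v≗u ⟨
      supp (restrictV e v)    ≡⟨ supp-restrictV e v ⟩
      restrictS e (supp v)    ≡⟨ cong (restrictS e) (c-minimal v S-v (subst (_⊆ _) (sym (supp-cong v≗u)) u⊆w)) ⟨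
      restrictS e (supp c)    ≡⟨ supp-restrictV e c ⟨
      supp (restrictV e c)    ∎
      where open ≡-Reasoning

any-function? : ∀ {m n} {P : (Fin m → Fin n) → Set} → (∀ {c c′} → c ≗ c′ → P c → P c′) →
  (∀ c → Dec (P c)) → Dec (∃ P)
any-function? {zero} resp P? with P? (λ ())
... | yes Pc = yes (_ , Pc)
... | no ¬Pc = no λ (c , Pc) → ¬Pc (resp (λ ()) Pc)
any-function? {suc m} {P = P} resp P?
  with any? (λ a → any-function? {P = λ c → P (cons a c)} (λ c≗c′ → resp (cons-cong c≗c′)) (P? ∘ cons a))
  where
  cons : ∀ {n} → Fin n → (Fin m → Fin n) → Fin (suc m) → Fin n
  cons a c zero    = a
  cons a c (suc i) = c i
  cons-cong : ∀ {n a} {c c′ : Fin m → Fin n} → c ≗ c′ → cons a c ≗ cons a c′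
  cons-cong c≗c′ zero    = refl
  cons-cong c≗c′ (suc i) = c≗c′ i
... | yes (a , c , Pc) = yes (_ , Pc)
... | no ¬P = no λ (c , Pc) → ¬P (c zero , (λ i → c (suc i)) , resp (λ { zero → refl ; (suc i) → refl }) Pc)

module _ {m n} (A : Matrix m n) where

  columns : (Fin m → Fin n) → Square m
  columns c i j = A i (c j)

  basis? : ∀ B → Dec (BasisA A B)
  basis? B = any-function? enumerates-resp enumerates?
    where
    Enumerates : (Fin m → Fin n) → Set
    Enumerates c = Injective c × (∀ i → c i ∈ B) × (∀ x → x ∈ B → ∃ λ i → c i ≡ x)
                   × det (columns c) ≢ 0ℤ
    enumerates-resp : ∀ {c c′} → c ≗ c′ → Enumerates c → Enumerates c′
    enumerates-resp c≗c′ (c-inj , c∈B , c-onto , det≢0) =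
      (λ i j eq → c-inj i j (trans (c≗c′ i) (trans eq (sym (c≗c′ j))))) ,
      (λ i → subst (_∈ B) (c≗c′ i) (c∈B i)) ,
      (λ x x∈B → let i , ci≡x = c-onto x x∈B in i , trans (sym (c≗c′ i)) ci≡x) ,
      (λ eq → det≢0 (trans (det-cong (λ r j → cong (A r) (c≗c′ j))) eq))
    enumerates? : ∀ c → Dec (Enumerates c)
    enumerates? c = all? (λ i → all? λ j → c i ≟ c j →-dec i ≟ j)
              ×-dec all? (λ i → c i ∈? B)
              ×-dec all? (λ x → x ∈? B →-dec any? λ i → c i ≟ x)
              ×-dec ¬? (det (columns c) ℤ.≟ 0ℤ)

  independent? : ∀ X → Dec (∃ λ B → BasisA A B × X ⊆ B)
  independent? X = anySubset? λ B → basis? B ×-dec X ⊆? B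

  dependent? : ∀ X → Dec (Dependent (BasisA A) X)
  dependent? X = map′ ¬independent⇒dependent dependent⇒¬independent (¬? (independent? X))
    where
    ¬independent⇒dependent : ¬ (∃ λ B → BasisA A B × X ⊆ B) → Dependent (BasisA A) X
    ¬independent⇒dependent ¬indep B B-basis X⊆B = ¬indep (B , B-basis , X⊆B)
    dependent⇒¬independent : Dependent (BasisA A) X → ¬ (∃ λ B → BasisA A B × X ⊆ B)
    dependent⇒¬independent X-dep (B , B-basis , X⊆B) = X-dep B B-basis X⊆B

  basis-replace : ∀ {B y} (c : Fin m → Fin n) → Injective c → (∀ x → x ∈ B → ∃ λ i → c i ≡ x) →
    (∀ i → c i ∈ B) → y ∉ B → ∀ j → det (columns (updateAt c j (const y))) ≢ 0ℤ →
    BasisA A ((B - c j) ∪ ⁅ y ⁆)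
  basis-replace {B} {y} c c-inj c-onto c∈B y∉B j det≢0 = c′ , c′-inj , c′∈ , c′-onto , det≢0
    where
    c′ = updateAt c j (const y)
    c′-j : c′ j ≡ y
    c′-j = updateAt-updates j c
    c′-other : ∀ {i} → i ≢ j → c′ i ≡ c i
    c′-other {i} i≢j = updateAt-minimal i j c i≢j
    c≢y : ∀ i → c i ≢ y
    c≢y i ci≡y = y∉B (subst (_∈ B) ci≡y (c∈B i))
    c′-inj : Injective c′
    c′-inj i i′ eq with i ≟ j | i′ ≟ j
    ... | yes refl | yes refl = refl
    ... | yes refl | no i′≢j  = ⊥-elim (c≢y i′ (trans (sym (c′-other i′≢j)) (trans (sym eq) c′-j)))
    ... | no i≢j   | yes refl = ⊥-elim (c≢y i (trans (sym (c′-other i≢j)) (trans eq c′-j)))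
    ... | no i≢j   | no i′≢j  = c-inj i i′ (trans (sym (c′-other i≢j)) (trans eq (c′-other i′≢j)))
    c′∈ : ∀ i → c′ i ∈ (B - c j) ∪ ⁅ y ⁆
    c′∈ i with i ≟ j
    ... | yes refl = x∈p∪⁅y⁆⁺ (inj₂ c′-j)
    ... | no i≢j rewrite c′-other i≢j =
      x∈p∪⁅y⁆⁺ (inj₁ (x∈p∧x≢y⇒x∈p-y (c∈B i) (i≢j ∘ c-inj i j)))
    c′-onto : ∀ x → x ∈ (B - c j) ∪ ⁅ y ⁆ → ∃ λ i → c′ i ≡ x
    c′-onto x x∈ with x∈p∪⁅y⁆⁻ x∈
    ... | inj₂ refl = j , c′-j
    ... | inj₁ x∈B-cj with x∈B , x≢cj ← x∈p-y⁻ x∈B-cj | c-onto x x∈B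
    ...   | i , refl = i , c′-other (x≢cj ∘ cong c)

  -- Cramer: W t, the determinant of the basis columns with column z replaced by column t, is a
  -- row-space vector vanishing on B − z with W z ≠ 0; orthogonality to v forces W y ≠ 0.
  basis-exchange : ∀ {B v y z} → BasisA A B → InKernel A v → supp v ⊆ B ∪ ⁅ y ⁆ → y ∉ B →
    z ∈ B → z ∈ supp v → BasisA A ((B - z) ∪ ⁅ y ⁆)
  basis-exchange {B} {v} {y} (c , c-inj , c∈B , c-onto , det≢0) v∈ker v⊆B+y y∉B z∈B z∈v
    with j , refl ← c-onto _ z∈B =
    basis-replace c c-inj c-onto c∈B y∉B j
      (proj₁ (rowSpace⊥kernel-pair A (c j) y W∈rowSpace v∈ker cj≢y disjoint W-cj≢0 (∈-supp⁻ z∈v)))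
    where
    W : Vector n
    W t = det (columns (updateAt c j (const t)))
    γ = proj₁ (det-linearInColumn (columns c) j)
    W≡γA : ∀ t → W t ≡ sum (λ r → A r t * γ r)
    W≡γA t = trans (proj₂ (det-linearInColumn (columns c) j) _ agree)
                   (sum-cong-≗ λ r → cong (λ s → A r s * γ r) (updateAt-updates j c))
      where
      agree : AgreeOffColumn j (columns (updateAt c j (const t))) (columns c)
      agree r i i≢j = cong (A r) (updateAt-minimal i j c i≢j)
    W∈rowSpace : InRowSpace A W
    W∈rowSpace = inRowSpace-≗ A (sym ∘ W≡γA) (rowCombination-inRowSpace A γ)
    W-cj≢0 : W (c j) ≢ 0ℤ
    W-cj≢0 = det≢0 ∘ trans (sym (det-cong λ r i → cong (A r) (updateAt-id-local j c refl i)))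
    cj≢y : c j ≢ y
    cj≢y cj≡y = y∉B (subst (_∈ B) cj≡y z∈B)
    disjoint : ∀ t → t ≢ c j → t ≢ y → W t ≡ 0ℤ ⊎ v t ≡ 0ℤ
    disjoint t t≢cj t≢y with t ∈? supp v
    ... | no t∉v = inj₂ (∉-supp t∉v)
    ... | yes t∈v with x∈p∪⁅y⁆⁻ (v⊆B+y t∈v)
    ...   | inj₂ t≡y = ⊥-elim (t≢y t≡y)
    ...   | inj₁ t∈B with l , refl ← c-onto t t∈B =
      inj₁ (det-equal-columns _ l j (t≢cj ∘ cong c) λ r →
        trans (cong (A r) (updateAt-minimal l j c (t≢cj ∘ cong c)))
              (cong (A r) (sym (updateAt-updates j c))))

  basis-pigeonhole : ∀ {B} → BasisA A B → (g : Fin (suc m) → Fin n) → Injective g → ¬ (∀ i → g i ∈ B)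
  basis-pigeonhole (c , _ , _ , c-onto , _) g g-inj g∈B
    with i , i′ , i<i′ , same-index ← pigeonhole (ℕₚ.n<1+n m) (λ i → proj₁ (c-onto (g i) (g∈B i))) =
    <⇒≢ i<i′ (g-inj i i′ (trans (sym (index-of i)) (trans (cong c same-index) (index-of i′))))
    where
    index-of : ∀ i → c (proj₁ (c-onto (g i) (g∈B i))) ≡ g i
    index-of i = proj₂ (c-onto (g i) (g∈B i))

  dependent-insert : ∀ {B y} → BasisA A B → y ∉ B → Dependent (BasisA A) (B ∪ ⁅ y ⁆)
  dependent-insert {B} {y} (c , c-inj , c∈B , _) y∉B B′ B′-basis B+y⊆B′ =
    basis-pigeonhole B′-basis y∷c y∷c-inj (λ i → B+y⊆B′ (y∷c∈ i))
    where
    y∷c : Fin (suc m) → Fin n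
    y∷c zero    = y
    y∷c (suc i) = c i
    c≢y : ∀ i → c i ≢ y
    c≢y i ci≡y = y∉B (subst (_∈ B) ci≡y (c∈B i))
    y∷c-inj : Injective y∷c
    y∷c-inj zero    zero     _  = refl
    y∷c-inj zero    (suc i′) eq = ⊥-elim (c≢y i′ (sym eq))
    y∷c-inj (suc i) zero     eq = ⊥-elim (c≢y i eq)
    y∷c-inj (suc i) (suc i′) eq = cong suc (c-inj i i′ eq)
    y∷c∈ : ∀ i → y∷c i ∈ B ∪ ⁅ y ⁆
    y∷c∈ zero    = x∈p∪⁅y⁆⁺ (inj₂ refl)
    y∷c∈ (suc i) = x∈p∪⁅y⁆⁺ (inj₁ (c∈B i))

  HasSignedCircuits : Set
  HasSignedCircuits = ∀ C → Circuit (MA A) C → ∃ λ v → SCirc (MA A) v × supp v ≡ C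

  circuitSignature⇒hasSignedCircuits : ∀ {σ} → IsCircuitSignature (MA A) σ → HasSignedCircuits
  circuitSignature⇒hasSignedCircuits (σ-signed , σ-covers , _) C C-circuit
    with v , v∈σ , refl ← σ-covers C C-circuit = v , σ-signed v v∈σ , refl

  fundamental-signedCircuit : HasSignedCircuits → ∀ {B y} → BasisA A B → y ∉ B →
    ∃ λ v → SCirc (MA A) v × supp v ⊆ B ∪ ⁅ y ⁆
  fundamental-signedCircuit signed B-basis y∉B
    with C , C⊆B+y , C-circuit ← circuit-⊆ (BasisA A) dependent? (dependent-insert B-basis y∉B)
    with v , v-signed , refl ← signed C C-circuit = v , v-signed , C⊆B+y

  -- The fundamental circuit of y meets w only in {x, y}, so orthogonality makes it nonzero at x.
  basis-coexchange : HasSignedCircuits → ∀ {B w x y} → BasisA A B → InRowSpace A w →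
    supp w ⊆ ∁ B ∪ ⁅ x ⁆ → x ∈ B → y ∉ B → y ∈ supp w → BasisA A ((B - x) ∪ ⁅ y ⁆)
  basis-coexchange signed {B} {w} {x} {y} B-basis w∈A w⊆∁B+x x∈B y∉B y∈w
    with v , (_ , v∈ker , v-circuit) , v⊆B+y ← fundamental-signedCircuit signed B-basis y∉B =
    basis-exchange B-basis v∈ker v⊆B+y y∉B x∈B
      (∈-supp⁺ (proj₂ (rowSpace⊥kernel-pair A y x w∈A v∈ker y≢x disjoint (∈-supp⁻ y∈w)
                         (∈-supp⁻ (dependent-∋ (BasisA A) B-basis v⊆B+y (proj₁ v-circuit))))))
    where
    y≢x : y ≢ x
    y≢x refl = y∉B x∈B
    disjoint : ∀ t → t ≢ y → t ≢ x → w t ≡ 0ℤ ⊎ v t ≡ 0ℤ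
    disjoint t t≢y t≢x with t ∈? supp w | t ∈? supp v
    ... | no t∉w | _      = inj₁ (∉-supp t∉w)
    ... | yes _  | no t∉v = inj₂ (∉-supp t∉v)
    ... | yes t∈w | yes t∈v with x∈p∪⁅y⁆⁻ (w⊆∁B+x t∈w) | x∈p∪⁅y⁆⁻ (v⊆B+y t∈v)
    ...   | inj₂ t≡x  | _         = ⊥-elim (t≢x t≡x)
    ...   | _         | inj₂ t≡y  = ⊥-elim (t≢y t≡y)
    ...   | inj₁ t∈∁B | inj₁ t∈B  = ⊥-elim (x∈∁p⇒x∉p t∈∁B t∈B)

  circuit-basisBetween : ∀ {B c y} → BasisA A B → y ∉ B → InKernel A c → supp c ⊆ B ∪ ⁅ y ⁆ →
    ∀ {i} → i ∈ supp c → BasisBetween (BasisA A) ((B ∪ ⁅ y ⁆) - i) (B ∪ ⁅ y ⁆)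
  circuit-basisBetween {B} {c} {y} B-basis y∉B c∈ker c⊆B+y {i} i∈c with i ≟ y | x∈p∪⁅y⁆⁻ (c⊆B+y i∈c)
  ... | yes refl | _ = B , B-basis , p∪⁅y⁆-y⊆p , p⊆p∪q ⁅ y ⁆
  ... | no i≢y | inj₂ i≡y = ⊥-elim (i≢y i≡y)
  ... | no _   | inj₁ i∈B = (B - i) ∪ ⁅ y ⁆ , basis-exchange B-basis c∈ker c⊆B+y y∉B i∈B i∈c ,
                            p∪⁅y⁆-i⊆p-i∪⁅y⁆ , p-i∪⁅y⁆⊆p∪⁅y⁆

  cocircuit-cobasisBetween : HasSignedCircuits → ∀ {B c x} → BasisA A B → x ∈ B → InRowSpace A c →
    supp c ⊆ ∁ B ∪ ⁅ x ⁆ → ∀ {i} → i ∈ supp c → CobasisBetween (BasisA A) ((∁ B ∪ ⁅ x ⁆) - i) (∁ B ∪ ⁅ x ⁆)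
  cocircuit-cobasisBetween signed {B} {c} {x} B-basis x∈B c∈A c⊆∁B+x {i} i∈c
    with i ≟ x | x∈p∪⁅y⁆⁻ (c⊆∁B+x i∈c)
  ... | yes refl | _ = B , B-basis , p∪⁅y⁆-y⊆p , p⊆p∪q ⁅ x ⁆
  ... | no i≢x | inj₂ i≡x = ⊥-elim (i≢x i≡x)
  ... | no _   | inj₁ i∈∁B =
    (B - x) ∪ ⁅ i ⁆ , basis-coexchange signed B-basis c∈A c⊆∁B+x x∈B (x∈∁p⇒x∉p i∈∁B) i∈c ,
    ∁p∪⁅x⁆-i⊆∁[p-x∪⁅i⁆] , ∁[p-x∪⁅i⁆]⊆∁p∪⁅x⁆

module Cases {m k} (A : Matrix m (suc k)) {σ σ* : Signature (suc k)}
  (σ-sig : IsCircuitSignature (MA A) σ) (σ*-sig : IsCocircuitSignature (MA A) σ*)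
  {B : Subset (suc k)} (B-basis : BasisA A B) (e : Fin (suc k)) where

  private
    D = MA A
    ι = punchIn e

    σ-signed : ∀ v → σ v → SCirc D v
    σ-signed = proj₁ σ-sig

    σ*-signed : ∀ v → σ* v → SCocirc D v
    σ*-signed = proj₁ σ*-sig

    signed : HasSignedCircuits A
    signed = circuitSignature⇒hasSignedCircuits A σ-sig

    e∈-ι : ∀ {Z} i → e ∈ Z → e ∈ Z - ι i
    e∈-ι i e∈Z = x∈p∧x≢y⇒x∈p-y e∈Z (punchInᵢ≢i e i ∘ sym)

    e∉-∪⁅ι⁆ : ∀ {Y} x → e ∉ Y → e ∉ Y ∪ ⁅ ι x ⁆
    e∉-∪⁅ι⁆ {Y} x e∉Y e∈ with x∈p∪⁅y⁆⁻ e∈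
    ... | inj₁ e∈Y = e∉Y e∈Y
    ... | inj₂ e≡ιx = punchInᵢ≢i e x (sym e≡ιx)

  contract-circuits : e ∈ B → ∀ F → IsFσ D B σ F →
    IsFσ (D ／ e) (restrictS e B) (sigCon D σ e) (restrictF e F)
  contract-circuits e∈B F F-is x = proj₁ (F-is (ι x)) ∘ ∈-restrictS⁻ e , λ x∉B′ →
    let ιx∉B = x∉B′ ∘ ∈-restrictS⁺ e
        exists , unique = proj₂ (F-is (ι x)) ιx∉B
    in restricted ιx∉B exists , λ _ w∈σ′ _ w⊆Z′ → unrestricted unique w∈σ′ w⊆Z′
    where
    Z = B ∪ ⁅ ι x ⁆
    Z′ = restrictS e B ∪ ⁅ x ⁆
    open Restriction e {Z} (restrictS-∪⁅⁆ e B x)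
    e∈Z : e ∈ Z
    e∈Z = x∈p∪⁅y⁆⁺ (inj₁ e∈B)

    restricted : ι x ∉ B → (∃ λ c → σ c × Circuit D (supp c) × supp c ⊆ Z) →
      ∃ λ w → sigCon D σ e w × Circuit (D ／ e) (supp w) × supp w ⊆ Z′
    restricted ιx∉B (c , c∈σ , (c-dep , _) , c⊆Z) =
      restrictV e c ,
      ((c , c∈σ , λ _ → refl) , restrictV-supportMinimal e (σ-signed c c∈σ) nonzero minimal) ,
      isCircuit-fundamental (Basis (D ／ e)) (supp-restrictV-⊆ c c⊆Z)
        (subst (Dependent _) (sym (supp-restrictV e c)) (dependent-／ D e c-dep)) between′ ,
      supp-restrictV-⊆ c c⊆Z
      where
      between : ∀ {t} → t ∈ supp c → BasisBetween (BasisA A) (Z - t) Z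
      between = circuit-basisBetween A {c = c} B-basis ιx∉B (proj₁ (proj₂ (σ-signed c c∈σ))) c⊆Z
      between′ : ∀ {i} → i ∈ supp (restrictV e c) → BasisBetween (Basis (D ／ e)) (Z′ - i) Z′
      between′ {i} i∈w = between-restrict (BasisBetween (Basis (D ／ e)))
        (basisBetween-／ D e (e∈-ι i e∈Z) (between (∈-supp-restrictV⁻ e c i∈w)))
      nonzero : Nonzero (restrictV e c)
      nonzero = x , ∈-supp⁻ {v = restrictV e c} (∈-supp-restrictV⁺ e c (dependent-∋ (BasisA A) B-basis c⊆Z c-dep))
      minimal : ∀ v → SCirc D v → supp (restrictV e v) ⊆ supp (restrictV e c) → supp c ≡ supp v
      minimal v (_ , _ , v-circuit) v′⊆w = circuit-unique (BasisA A) c-dep between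
        (supp-unrestrict-⊆ v (λ _ → refl) (supp-restrictV-⊆ c c⊆Z ∘ v′⊆w) (inj₂ e∈Z)) v-circuit

    unrestricted : (∀ c → σ c → Circuit D (supp c) → supp c ⊆ Z → F (ι x) ≡ signOf (c (ι x))) →
      ∀ {w} → sigCon D σ e w → supp w ⊆ Z′ → F (ι x) ≡ signOf (w x)
    unrestricted unique ((v , v∈σ , v≗w) , _) w⊆Z′ =
      trans (unique v v∈σ (proj₂ (proj₂ (σ-signed v v∈σ))) (supp-unrestrict-⊆ v v≗w w⊆Z′ (inj₂ e∈Z)))
            (cong signOf (v≗w x))

  delete-circuits : e ∉ B → ∀ F → IsFσ D B σ F →
    IsFσ (D ∖ e) (restrictS e B) (sigDel D σ e) (restrictF e F)
  delete-circuits e∉B F F-is x = proj₁ (F-is (ι x)) ∘ ∈-restrictS⁻ e , λ x∉B′ →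
    let ιx∉B = x∉B′ ∘ ∈-restrictS⁺ e
        exists , unique = proj₂ (F-is (ι x)) ιx∉B
    in restricted ιx∉B exists , λ _ w∈σ′ _ w⊆Z′ → unrestricted unique w∈σ′ w⊆Z′
    where
    Z = B ∪ ⁅ ι x ⁆
    Z′ = restrictS e B ∪ ⁅ x ⁆
    open Restriction e {Z} (restrictS-∪⁅⁆ e B x)
    e∉Z : e ∉ Z
    e∉Z = e∉-∪⁅ι⁆ x e∉B

    restricted : ι x ∉ B → (∃ λ c → σ c × Circuit D (supp c) × supp c ⊆ Z) →
      ∃ λ w → sigDel D σ e w × Circuit (D ∖ e) (supp w) × supp w ⊆ Z′
    restricted ιx∉B (c , c∈σ , (c-dep , _) , c⊆Z) =
      restrictV e c ,
      ((c , c∈σ , λ _ → refl) , (c , σ-signed c c∈σ , ∉-supp {v = c} (e∉Z ∘ c⊆Z) , λ _ → refl)) ,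
      isCircuit-fundamental (Basis (D ∖ e)) (supp-restrictV-⊆ c c⊆Z)
        (subst (Dependent _) (sym (supp-restrictV e c)) (dependent-∖ D e (e∉Z ∘ c⊆Z) c-dep)) between′ ,
      supp-restrictV-⊆ c c⊆Z
      where
      between′ : ∀ {i} → i ∈ supp (restrictV e c) → BasisBetween (Basis (D ∖ e)) (Z′ - i) Z′
      between′ {i} i∈w = between-restrict (BasisBetween (Basis (D ∖ e))) (basisBetween-∖ D e e∉Z
        (circuit-basisBetween A {c = c} B-basis ιx∉B (proj₁ (proj₂ (σ-signed c c∈σ))) c⊆Z
          (∈-supp-restrictV⁻ e c i∈w)))

    unrestricted : (∀ c → σ c → Circuit D (supp c) → supp c ⊆ Z → F (ι x) ≡ signOf (c (ι x))) →
      ∀ {w} → sigDel D σ e w → supp w ⊆ Z′ → F (ι x) ≡ signOf (w x)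
    unrestricted unique ((v , v∈σ , v≗w) , (v′ , (_ , _ , (v′-dep , _)) , v′e≡0 , v′≗w)) w⊆Z′ =
      trans (unique v v∈σ v-circuit (supp-unrestrict-⊆ v v≗w w⊆Z′ (inj₁ e∉v))) (cong signOf (v≗w x))
      where
      v-circuit = proj₂ (proj₂ (σ-signed v v∈σ))
      e∉v : e ∉ supp v
      e∉v e∈v = ∈-supp⁻ {v = v} e∈v (minimal-vanishes-at-e e v v′ v′-dep (proj₂ v-circuit) v′e≡0 v≗w v′≗w)

  contract-cocircuits : e ∈ B → ∀ F → IsFσ* D B σ* F →
    IsFσ* (D ／ e) (restrictS e B) (cosigCon D σ* e) (restrictF e F)
  contract-cocircuits e∈B F F-is x = proj₁ (F-is (ι x)) ∘ (λ x∉B′ → x∉B′ ∘ ∈-restrictS⁺ e) , λ x∈B′ →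
    let ιx∈B = ∈-restrictS⁻ e x∈B′
        exists , unique = proj₂ (F-is (ι x)) ιx∈B
    in restricted ιx∈B exists , λ _ w∈σ′ _ w⊆Z′ → unrestricted unique w∈σ′ w⊆Z′
    where
    Z = ∁ B ∪ ⁅ ι x ⁆
    Z′ = ∁ (restrictS e B) ∪ ⁅ x ⁆
    open Restriction e {Z} (trans (restrictS-∪⁅⁆ e (∁ B) x) (cong (_∪ ⁅ x ⁆) (restrictS-∁ e B)))
    e∉Z : e ∉ Z
    e∉Z = e∉-∪⁅ι⁆ x (λ e∈∁B → x∈∁p⇒x∉p e∈∁B e∈B)

    restricted : ι x ∈ B → (∃ λ c → σ* c × Cocircuit D (supp c) × supp c ⊆ Z) →
      ∃ λ w → cosigCon D σ* e w × Cocircuit (D ／ e) (supp w) × supp w ⊆ Z′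
    restricted ιx∈B (c , c∈σ* , (c-meets , _) , c⊆Z) =
      restrictV e c ,
      ((c , c∈σ* , λ _ → refl) , (c , σ*-signed c c∈σ* , ∉-supp {v = c} (e∉Z ∘ c⊆Z) , λ _ → refl)) ,
      isCocircuit-fundamental (Basis (D ／ e)) (supp-restrictV-⊆ c c⊆Z)
        (subst (MeetsAll _) (sym (supp-restrictV e c)) (meetsAll-／ D e (e∉Z ∘ c⊆Z) c-meets)) between′ ,
      supp-restrictV-⊆ c c⊆Z
      where
      between′ : ∀ {i} → i ∈ supp (restrictV e c) → CobasisBetween (Basis (D ／ e)) (Z′ - i) Z′
      between′ {i} i∈w = between-restrict (CobasisBetween (Basis (D ／ e))) (cobasisBetween-／ D e e∉Z
        (cocircuit-cobasisBetween A signed {c = c} B-basis ιx∈B (proj₁ (proj₂ (σ*-signed c c∈σ*))) c⊆Z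
          (∈-supp-restrictV⁻ e c i∈w)))

    unrestricted : (∀ c → σ* c → Cocircuit D (supp c) → supp c ⊆ Z → F (ι x) ≡ signOf (c (ι x))) →
      ∀ {w} → cosigCon D σ* e w → supp w ⊆ Z′ → F (ι x) ≡ signOf (w x)
    unrestricted unique ((v , v∈σ* , v≗w) , (v′ , (_ , _ , (v′-meets , _)) , v′e≡0 , v′≗w)) w⊆Z′ =
      trans (unique v v∈σ* v-cocircuit (supp-unrestrict-⊆ v v≗w w⊆Z′ (inj₁ e∉v))) (cong signOf (v≗w x))
      where
      v-cocircuit = proj₂ (proj₂ (σ*-signed v v∈σ*))
      e∉v : e ∉ supp v
      e∉v e∈v = ∈-supp⁻ {v = v} e∈v (minimal-vanishes-at-e e v v′ v′-meets (proj₂ v-cocircuit) v′e≡0 v≗w v′≗w)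

  delete-cocircuits : e ∉ B → ∀ F → IsFσ* D B σ* F →
    IsFσ* (D ∖ e) (restrictS e B) (cosigDel D σ* e) (restrictF e F)
  delete-cocircuits e∉B F F-is x = proj₁ (F-is (ι x)) ∘ (λ x∉B′ → x∉B′ ∘ ∈-restrictS⁺ e) , λ x∈B′ →
    let ιx∈B = ∈-restrictS⁻ e x∈B′
        exists , unique = proj₂ (F-is (ι x)) ιx∈B
    in restricted ιx∈B exists , λ _ w∈σ′ _ w⊆Z′ → unrestricted unique w∈σ′ w⊆Z′
    where
    Z = ∁ B ∪ ⁅ ι x ⁆
    Z′ = ∁ (restrictS e B) ∪ ⁅ x ⁆
    open Restriction e {Z} (trans (restrictS-∪⁅⁆ e (∁ B) x) (cong (_∪ ⁅ x ⁆) (restrictS-∁ e B)))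
    e∈Z : e ∈ Z
    e∈Z = x∈p∪⁅y⁆⁺ (inj₁ (x∉p⇒x∈∁p e∉B))

    restricted : ι x ∈ B → (∃ λ c → σ* c × Cocircuit D (supp c) × supp c ⊆ Z) →
      ∃ λ w → cosigDel D σ* e w × Cocircuit (D ∖ e) (supp w) × supp w ⊆ Z′
    restricted ιx∈B (c , c∈σ* , (c-meets , _) , c⊆Z) =
      restrictV e c ,
      ((c , c∈σ* , λ _ → refl) , restrictV-supportMinimal e (σ*-signed c c∈σ*) nonzero minimal) ,
      isCocircuit-fundamental (Basis (D ∖ e)) (supp-restrictV-⊆ c c⊆Z)
        (subst (MeetsAll _) (sym (supp-restrictV e c)) (meetsAll-∖ D e c-meets)) between′ ,
      supp-restrictV-⊆ c c⊆Z
      where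
      between : ∀ {t} → t ∈ supp c → CobasisBetween (BasisA A) (Z - t) Z
      between = cocircuit-cobasisBetween A signed {c = c} B-basis ιx∈B (proj₁ (proj₂ (σ*-signed c c∈σ*))) c⊆Z
      between′ : ∀ {i} → i ∈ supp (restrictV e c) → CobasisBetween (Basis (D ∖ e)) (Z′ - i) Z′
      between′ {i} i∈w = between-restrict (CobasisBetween (Basis (D ∖ e)))
        (cobasisBetween-∖ D e (e∈-ι i e∈Z) (between (∈-supp-restrictV⁻ e c i∈w)))
      nonzero : Nonzero (restrictV e c)
      nonzero = x , ∈-supp⁻ {v = restrictV e c} (∈-supp-restrictV⁺ e c (meetsAll-∋ (BasisA A) B-basis c⊆Z c-meets))
      minimal : ∀ v → SCocirc D v → supp (restrictV e v) ⊆ supp (restrictV e c) → supp c ≡ supp v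
      minimal v (_ , _ , v-cocircuit) v′⊆w = cocircuit-unique (BasisA A) c-meets between
        (supp-unrestrict-⊆ v (λ _ → refl) (supp-restrictV-⊆ c c⊆Z ∘ v′⊆w) (inj₂ e∈Z)) v-cocircuit

    unrestricted : (∀ c → σ* c → Cocircuit D (supp c) → supp c ⊆ Z → F (ι x) ≡ signOf (c (ι x))) →
      ∀ {w} → cosigDel D σ* e w → supp w ⊆ Z′ → F (ι x) ≡ signOf (w x)
    unrestricted unique ((v , v∈σ* , v≗w) , _) w⊆Z′ =
      trans (unique v v∈σ* (proj₂ (proj₂ (σ*-signed v v∈σ*))) (supp-unrestrict-⊆ v v≗w w⊆Z′ (inj₂ e∈Z)))
            (cong signOf (v≗w x))

lemma2p44 : ∀ {m k} (A : Matrix m (suc k)) → TotallyUnimodular A → FullRowRank A →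
    (σ σ* : Signature (suc k)) →
    IsCircuitSignature (MA A) σ → IsCocircuitSignature (MA A) σ* →
    (B : Subset (suc k)) → Basis (MA A) B →
      ((e : Fin (suc k)) → e ∈ B →
          (∀ F → IsFσ (MA A) B σ F →
             IsFσ (MA A ／ e) (restrictS e B) (sigCon (MA A) σ e) (restrictF e F))
        × (∀ F → IsFσ* (MA A) B σ* F →
             IsFσ* (MA A ／ e) (restrictS e B) (cosigCon (MA A) σ* e) (restrictF e F)))
    × ((e : Fin (suc k)) → e ∉ B →
          (∀ F → IsFσ (MA A) B σ F →
             IsFσ (MA A ∖ e) (restrictS e B) (sigDel (MA A) σ e) (restrictF e F))
        × (∀ F → IsFσ* (MA A) B σ* F →
             IsFσ* (MA A ∖ e) (restrictS e B) (cosigDel (MA A) σ* e) (restrictF e F)))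
lemma2p44 A _ _ σ σ* σ-sig σ*-sig B B-basis =
  (λ e e∈B → let open Cases A σ-sig σ*-sig B-basis e in contract-circuits e∈B , contract-cocircuits e∈B) ,
  (λ e e∉B → let open Cases A σ-sig σ*-sig B-basis e in delete-circuits e∉B , delete-cocircuits e∉B)
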